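{- Let $D$ be an $\mathrm{R}^0(\mathrm{lin})$-line with $N$ variables and let $\widetilde D\subseteq\{0,1\}^N$ be the set of $0,1$ assignments satisfying $D$. Then $CC(\widetilde D)\le O(\log N)$.
   Context: A linear equation is $\vec a\cdot\vec x=a_0$ with integer coefficients; a disjunction of linear equations is satisfied iff some equation holds. A clause $\bigvee_{i\in I}x_i\vee\bigvee_{j\in J}\neg x_j$ translates to $\bigvee_{i\in I}(x_i=1)\vee\bigvee_{j\in J}(x_j=0)$. An $\mathrm{R}^0(\mathrm{lin})$-line is a disjunction of linear equations whose variable coefficients are integers bounded in absolute value by a fixed constant (free terms unbounded) and which can be partitioned into a constant number of sub-disjunctions each either consisting of equations differing only in their free terms or being a translated clause. Communication complexity: let $N=n+s+t$ and $A\subseteq\{0,1\}^N$. Player I knows $u\in\{0,1\}^n$, $q^u\in\{0,1\}^s$; Player II knows $v\in\{0,1\}^n$, $r^v\in\{0,1\}^t$. Tasks: (1) decide whether $(u,q^u,r^v)\in A$; (2) decide whether $(v,q^u,r^v)\in A$; (3) if exactly one of $(u,q^u,r^v)\in A$, $(v,q^u,r^v)\in A$ holds, find $i\in[n]$ with $u_i\ne v_i$. $CC(A)$ is the minimum over protocols of the worst-case number of bits exchanged to solve each of the three tasks. (The claim holds for any split $N=n+s+t$ of the variables.) -}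

module Defs where

open import Data.Bool using (Bool; true; false)
open import Data.Nat using (ℕ; zero; suc; _≤_; _+_; _*_)
open import Data.Integer as ℤ using (ℤ; +_; ∣_∣)
open import Data.Fin using (Fin)
open import Data.Vec using (Vec; []; _∷_; lookup; _++_; tabulate)
open import Data.List using (List; length; concat; map; _++_)
open import Data.List.Relation.Unary.All using (All)
open import Data.List.Relation.Unary.Any using (Any)
open import Data.List.Relation.Binary.Permutation.Propositional using (_↭_)
open import Data.Product using (Σ; ∃; ∃-syntax; _×_; _,_)
open import Data.Sum using (_⊎_)
open import Data.Maybe using (Maybe; just)
open import Relation.Binary.PropositionalEquality using (_≡_; _≢_)
open import Relation.Nullary using (¬_)
open import Relation.Nullary.Decidable using (⌊_⌋)
import Data.Fin as Fin
import Data.Vec.Relation.Unary.All as VAll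
import Data.Nat
import Data.Vec
import Data.List
import Data.Product

record LinEq (N : ℕ) : Set where
  constructor _≐_
  field
    coeffs : Vec ℤ N
    free   : ℤ
open LinEq public

bit : Bool → ℤ
bit true  = + 1
bit false = + 0

dot : ∀ {N} → Vec ℤ N → Vec Bool N → ℤ
dot []       []       = + 0
dot (a ∷ as) (b ∷ bs) = a ℤ.* bit b ℤ.+ dot as bs

SatEq : ∀ {N} → LinEq N → Vec Bool N → Set
SatEq e x = dot (coeffs e) x ≡ free e

Line : ℕ → Set
Line N = List (LinEq N)

SatLine : ∀ {N} → Line N → Vec Bool N → Set
SatLine D x = Any (λ e → SatEq e x) D

unitVec : ∀ {N} → Fin N → Vec ℤ N
unitVec i = tabulate (λ j → bit (⌊ i Fin.≟ j ⌋))

-- the translation of the clause  ⋁_{i∈I} x_i ∨ ⋁_{j∈J} ¬x_j :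
--   ⋁_{i∈I} (x_i = 1) ∨ ⋁_{j∈J} (x_j = 0)
translateClause : ∀ {N} → List (Fin N) → List (Fin N) → Line N
translateClause I J =
  map (λ i → unitVec i ≐ (+ 1)) I Data.List.++ map (λ j → unitVec j ≐ (+ 0)) J

SameForm : ∀ {N} → Line N → Set
SameForm {N} B = ∃[ a ] All (λ e → coeffs e ≡ a) B

IsTranslatedClause : ∀ {N} → Line N → Set
IsTranslatedClause B = ∃[ I ] ∃[ J ] (B ≡ translateClause I J)

CoeffBounded : ℕ → ∀ {N} → Line N → Set
CoeffBounded c D = All (λ e → VAll.All (λ a → ∣ a ∣ ≤ c) (coeffs e)) D

IsR0Line : (c k : ℕ) → ∀ {N} → Line N → Set
IsR0Line c k {N} D =
  CoeffBounded c D ×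
  ∃[ blocks ] (length blocks ≤ k ×
               All (λ B → SameForm B ⊎ IsTranslatedClause B) blocks ×
               concat blocks ↭ D)

data Protocol (X Y O : Set) : Set where
  leaf : O → Protocol X Y O
  sendI  : (X → Bool) → (Protocol X Y O) → (Protocol X Y O) → Protocol X Y O
  sendII : (Y → Bool) → (Protocol X Y O) → (Protocol X Y O) → Protocol X Y O

run : ∀ {X Y O} → Protocol X Y O → X → Y → O
run (leaf o)       x y = o
run (sendI f p q)  x y with f x
... | true  = run p x y
... | false = run q x y
run (sendII g p q) x y with g y
... | true  = run p x y
... | false = run q x y

cost : ∀ {X Y O} → Protocol X Y O → ℕ
cost (leaf _)       = 0
cost (sendI _ p q)  = suc (cost p Data.Nat.⊔ cost q)
cost (sendII _ p q) = suc (cost p Data.Nat.⊔ cost q)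

-- The communication problem CC(A), for N = n + s + t.
-- Player I knows (u , q), Player II knows (v , r).

InI : ℕ → ℕ → Set
InI n s = Vec Bool n × Vec Bool s

InII : ℕ → ℕ → Set
InII n t = Vec Bool n × Vec Bool t

assignU : ∀ {n s t} → InI n s → InII n t → Vec Bool (n + s + t)
assignU (u , q) (v , r) = (u Data.Vec.++ q) Data.Vec.++ r

assignV : ∀ {n s t} → InI n s → InII n t → Vec Bool (n + s + t)
assignV (u , q) (v , r) = (v Data.Vec.++ q) Data.Vec.++ r

_⇔_ : Set → Set → Set
P ⇔ Q = (P → Q) × (Q → P)

ExactlyOne : Set → Set → Set
ExactlyOne P Q = (P × ¬ Q) ⊎ (¬ P × Q)

CCLe : ∀ {n s t} → (Vec Bool (n + s + t) → Set) → ℕ → Set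
CCLe {n} {s} {t} A d =
  (Σ (Protocol (InI n s) (InII n t) Bool) λ P → cost P ≤ d ×
     (∀ x y → (run P x y ≡ true) ⇔ A (assignU x y))) ×
  (Σ (Protocol (InI n s) (InII n t) Bool) λ P → cost P ≤ d ×
     (∀ x y → (run P x y ≡ true) ⇔ A (assignV x y))) ×
  (Σ (Protocol (InI n s) (InII n t) (Maybe (Fin n))) λ P → cost P ≤ d ×
     (∀ x y → ExactlyOne (A (assignU x y)) (A (assignV x y)) →
        ∃[ i ] (run P x y ≡ just i ×
                lookup (Data.Product.proj₁ x) i ≢ lookup (Data.Product.proj₁ y) i)))

module Submission where

-- For tasks (1) and (2) the players decide the line block by block. A translated clause costs two
-- bits: each player says whether some literal on its own coordinates holds. For a block a·x ∈ F,
-- Player I sends its part of a·x, an integer of absolute value at most c N, in O(log N) bits, and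
-- Player II finishes the evaluation. There are at most k blocks.
--
-- For task (3) the players run these two deciders block by block until they reach a block that
-- exactly one of the assignments (u, q, r) and (v, q, r) satisfies. For a clause, a literal that
-- holds in one assignment and fails in the other is about u or v, and the player whose assignment
-- satisfies the clause announces its index. For a block a·x ∈ F we have a·u ≠ a·v with bounded
-- coefficients. A balanced tree of carry-save adders of depth O(log N) writes a·u, after splitting
-- a into its positive and negative parts, as sums of two O(log N)-bit numbers whose bits are
-- fan-in-3 formulas of depth O(log N) in u. The Karchmer–Wigderson game of such a formula costs
-- O(log N), so comparing those numbers bit by bit and then playing the game of the first differing
-- bit finds an i with u_i ≠ v_i in O(log N) bits.

open import Defs
open import Data.Nat using (ℕ; _≤_; _+_; _*_)
open import Data.Nat.Logarithm using (⌈log₂_⌉; ⌈log₂⌈n/2⌉⌉≡⌈log₂n⌉∸1)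
open import Data.Product using (∃-syntax)

open import Data.Bool as Bool using (Bool; true; false; _∧_; _∨_; if_then_else_)
import Data.Bool.Properties as Bool
open import Data.Empty using (⊥; ⊥-elim)
open import Data.Fin as Fin using (Fin; _↑ˡ_; _↑ʳ_)
import Data.Fin.Properties as Fin
open import Data.Integer as ℤ using (ℤ; -[1+_]; ∣_∣)
import Data.Integer.Properties as ℤ
open import Data.Integer.Tactic.RingSolver renaming (solve-∀ to ℤ-solve-∀)
open import Data.List as List using (List; []; _∷_)
import Data.List.Properties as List
open import Data.List.Relation.Binary.Permutation.Propositional using (↭-sym)
open import Data.List.Relation.Binary.Permutation.Propositional.Properties using (Any-resp-↭; All-resp-↭)
open import Data.List.Relation.Unary.All as All using (All; []; _∷_)
import Data.List.Relation.Unary.All.Properties as AllP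
open import Data.List.Relation.Unary.Any as LAny using (Any; here; there)
import Data.List.Relation.Unary.Any.Properties as LAny
open import Data.Maybe as Maybe using (Maybe; just; nothing)
open import Data.Nat as ℕ using (zero; suc; _<_; _∸_; _⊔_; _^_; z≤n; s≤s; ⌊_/2⌋)
open import Data.Nat.Induction using (<-rec)
import Data.Nat.Properties as ℕ
open import Data.Nat.Tactic.RingSolver using (solve-∀)
open import Data.Product as Product using (Σ; _×_; _,_; proj₁; proj₂)
open import Data.Sum as Sum using (_⊎_; inj₁; inj₂; [_,_]′)
open import Data.Unit using (⊤; tt)
open import Data.Vec as Vec using (Vec; []; _∷_; _++_; lookup; replicate)
import Data.Vec.Properties as Vec
import Data.Vec.Relation.Unary.All as VAll
import Data.Vec.Relation.Unary.All.Properties as VAll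
open import Function using (_∘_; id; case_of_)
open import Relation.Binary.PropositionalEquality
  using (_≡_; _≢_; refl; sym; trans; cong; cong₂; subst; subst₂; module ≡-Reasoning)
open import Relation.Nullary using (¬_; Dec; yes; no)
open import Relation.Nullary.Decidable as Dec using (isYes)

private
  variable
    X Y X′ Y′ O O′ : Set

_>>=_ : Protocol X Y O → (O → Protocol X Y O′) → Protocol X Y O′
leaf o       >>= k = k o
sendI f p q  >>= k = sendI f (p >>= k) (q >>= k)
sendII g p q >>= k = sendII g (p >>= k) (q >>= k)

run->>= : (p : Protocol X Y O) (k : O → Protocol X Y O′) (x : X) (y : Y) →
          run (p >>= k) x y ≡ run (k (run p x y)) x y
run->>= (leaf o)       k x y = refl
run->>= (sendI f p q)  k x y with f x
... | true  = run->>= p k x y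
... | false = run->>= q k x y
run->>= (sendII g p q) k x y with g y
... | true  = run->>= p k x y
... | false = run->>= q k x y

cost->>= : ∀ {c d} (p : Protocol X Y O) (k : O → Protocol X Y O′) →
           cost p ≤ c → (∀ o → cost (k o) ≤ d) → cost (p >>= k) ≤ c + d
cost->>= (leaf o)       k _        hk = ℕ.≤-trans (hk o) (ℕ.m≤n+m _ _)
cost->>= (sendI f p q)  k (s≤s hp) hk =
  s≤s (ℕ.⊔-lub (cost->>= p k (ℕ.m⊔n≤o⇒m≤o _ _ hp) hk) (cost->>= q k (ℕ.m⊔n≤o⇒n≤o _ _ hp) hk))
cost->>= (sendII g p q) k (s≤s hp) hk =
  s≤s (ℕ.⊔-lub (cost->>= p k (ℕ.m⊔n≤o⇒m≤o _ _ hp) hk) (cost->>= q k (ℕ.m⊔n≤o⇒n≤o _ _ hp) hk))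

_<$>_ : (O → O′) → Protocol X Y O → Protocol X Y O′
f <$> p = p >>= (leaf ∘ f)

run-<$> : (f : O → O′) (p : Protocol X Y O) (x : X) (y : Y) → run (f <$> p) x y ≡ f (run p x y)
run-<$> f p = run->>= p (leaf ∘ f)

cost-<$> : (f : O → O′) (p : Protocol X Y O) → cost (f <$> p) ≤ cost p
cost-<$> f p = ℕ.≤-trans (cost->>= p (leaf ∘ f) ℕ.≤-refl (λ _ → z≤n)) (ℕ.≤-reflexive (ℕ.+-identityʳ _))

comap : (X′ → X) → (Y′ → Y) → Protocol X Y O → Protocol X′ Y′ O
comap g h (leaf o)       = leaf o
comap g h (sendI f p q)  = sendI (f ∘ g) (comap g h p) (comap g h q)
comap g h (sendII f p q) = sendII (f ∘ h) (comap g h p) (comap g h q)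

run-comap : (g : X′ → X) (h : Y′ → Y) (p : Protocol X Y O) → ∀ x y →
            run (comap g h p) x y ≡ run p (g x) (h y)
run-comap g h (leaf o)       x y = refl
run-comap g h (sendI f p q)  x y with f (g x)
... | true  = run-comap g h p x y
... | false = run-comap g h q x y
run-comap g h (sendII f p q) x y with f (h y)
... | true  = run-comap g h p x y
... | false = run-comap g h q x y

cost-comap : (g : X′ → X) (h : Y′ → Y) (p : Protocol X Y O) → cost (comap g h p) ≡ cost p
cost-comap g h (leaf o)       = refl
cost-comap g h (sendI f p q)  = cong₂ (λ a b → suc (a ⊔ b)) (cost-comap g h p) (cost-comap g h q)
cost-comap g h (sendII f p q) = cong₂ (λ a b → suc (a ⊔ b)) (cost-comap g h p) (cost-comap g h q)

swap : Protocol X Y O → Protocol Y X O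
swap (leaf o)       = leaf o
swap (sendI f p q)  = sendII f (swap p) (swap q)
swap (sendII g p q) = sendI g (swap p) (swap q)

run-swap : (p : Protocol X Y O) → ∀ x y → run (swap p) y x ≡ run p x y
run-swap (leaf o)       x y = refl
run-swap (sendI f p q)  x y with f x
... | true  = run-swap p x y
... | false = run-swap q x y
run-swap (sendII g p q) x y with g y
... | true  = run-swap p x y
... | false = run-swap q x y

cost-swap : (p : Protocol X Y O) → cost (swap p) ≡ cost p
cost-swap (leaf o)       = refl
cost-swap (sendI f p q)  = cong₂ (λ a b → suc (a ⊔ b)) (cost-swap p) (cost-swap q)
cost-swap (sendII g p q) = cong₂ (λ a b → suc (a ⊔ b)) (cost-swap p) (cost-swap q)

sendBitsI : ∀ w → (X → Vec Bool w) → (Vec Bool w → Protocol X Y O) → Protocol X Y O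
sendBitsI zero    f k = k []
sendBitsI (suc w) f k =
  sendI (Vec.head ∘ f) (sendBitsI w (Vec.tail ∘ f) (k ∘ (true ∷_)))
                       (sendBitsI w (Vec.tail ∘ f) (k ∘ (false ∷_)))

run-sendBitsI : ∀ w f (k : Vec Bool w → Protocol X Y O) x y →
                run (sendBitsI w f k) x y ≡ run (k (f x)) x y
run-sendBitsI zero    f k x y with f x
... | [] = refl
run-sendBitsI (suc w) f k x y with f x in eq
... | true ∷ _ =
  trans (run-sendBitsI w _ _ x y) (cong (λ v → run (k (true ∷ Vec.tail v)) x y) eq)
... | false ∷ _ =
  trans (run-sendBitsI w _ _ x y) (cong (λ v → run (k (false ∷ Vec.tail v)) x y) eq)

cost-sendBitsI : ∀ w f (k : Vec Bool w → Protocol X Y O) {d} →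
                 (∀ bs → cost (k bs) ≤ d) → cost (sendBitsI w f k) ≤ w + d
cost-sendBitsI zero    f k hk = hk []
cost-sendBitsI (suc w) f k hk =
  s≤s (ℕ.⊔-lub (cost-sendBitsI w _ _ (hk ∘ (true ∷_))) (cost-sendBitsI w _ _ (hk ∘ (false ∷_))))

boolToℕ : Bool → ℕ
boolToℕ true  = 1
boolToℕ false = 0

lsb : ℕ → Bool
lsb zero          = false
lsb (suc zero)    = true
lsb (suc (suc m)) = lsb m

lsb+2*⌊n/2⌋≡n : ∀ m → boolToℕ (lsb m) + 2 * ⌊ m /2⌋ ≡ m
lsb+2*⌊n/2⌋≡n zero          = refl
lsb+2*⌊n/2⌋≡n (suc zero)    = refl
lsb+2*⌊n/2⌋≡n (suc (suc m)) = begin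
  boolToℕ (lsb m) + 2 * suc ⌊ m /2⌋     ≡⟨ cong (boolToℕ (lsb m) +_) (ℕ.*-suc 2 ⌊ m /2⌋) ⟩
  boolToℕ (lsb m) + (2 + 2 * ⌊ m /2⌋)   ≡⟨ ℕ.+-comm (boolToℕ (lsb m)) _ ⟩
  2 + (2 * ⌊ m /2⌋ + boolToℕ (lsb m))   ≡⟨ cong (suc ∘ suc) (ℕ.+-comm _ (boolToℕ (lsb m))) ⟩
  2 + (boolToℕ (lsb m) + 2 * ⌊ m /2⌋)   ≡⟨ cong (suc ∘ suc) (lsb+2*⌊n/2⌋≡n m) ⟩
  suc (suc m)                           ∎
  where open ≡-Reasoning

-- Little-endian. Like the adders below, defined by recursion on the width through head and tail, so
-- that it computes on bit vectors F u that are not in constructor form.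
fromBits : ∀ {w} → Vec Bool w → ℕ
fromBits {zero}  _  = 0
fromBits {suc w} bs = boolToℕ (Vec.head bs) + 2 * fromBits (Vec.tail bs)

toBits : ∀ w → ℕ → Vec Bool w
toBits zero    _ = []
toBits (suc w) m = lsb m ∷ toBits w ⌊ m /2⌋

fromBits-toBits : ∀ w {m} → m < 2 ^ w → fromBits (toBits w m) ≡ m
fromBits-toBits zero    (s≤s z≤n) = refl
fromBits-toBits (suc w) {m} m<2^1+w = begin
  boolToℕ (lsb m) + 2 * fromBits (toBits w ⌊ m /2⌋)
    ≡⟨ cong (λ k → boolToℕ (lsb m) + 2 * k) (fromBits-toBits w ⌊m/2⌋<2^w) ⟩
  boolToℕ (lsb m) + 2 * ⌊ m /2⌋
    ≡⟨ lsb+2*⌊n/2⌋≡n m ⟩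
  m ∎
  where
  open ≡-Reasoning
  ⌊m/2⌋<2^w : ⌊ m /2⌋ < 2 ^ w
  ⌊m/2⌋<2^w = ℕ.*-cancelˡ-< 2 _ _ (ℕ.≤-<-trans
    (subst (2 * ⌊ m /2⌋ ≤_) (lsb+2*⌊n/2⌋≡n m) (ℕ.m≤n+m _ (boolToℕ (lsb m)))) m<2^1+w)

ℤ→bits : ∀ w → ℤ → Vec Bool (suc w)
ℤ→bits w (ℤ.+ m)  = true  ∷ toBits w m
ℤ→bits w -[1+ m ] = false ∷ toBits w m

bits→ℤ : ∀ {w} → Vec Bool (suc w) → ℤ
bits→ℤ (true  ∷ bs) = ℤ.+ fromBits bs
bits→ℤ (false ∷ bs) = -[1+ fromBits bs ]

bits→ℤ-ℤ→bits : ∀ w {z} → ∣ z ∣ < 2 ^ w → bits→ℤ (ℤ→bits w z) ≡ z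
bits→ℤ-ℤ→bits w {ℤ.+ m}      m<2^w   = cong ℤ.+_ (fromBits-toBits w m<2^w)
bits→ℤ-ℤ→bits w { -[1+ m ] } 1+m<2^w = cong -[1+_] (fromBits-toBits w (ℕ.<-trans (ℕ.n<1+n m) 1+m<2^w))

SearchProtocol : ℕ → Set
SearchProtocol N = Protocol (Vec Bool N) (Vec Bool N) (Maybe (Fin N))

FindsDifference : ∀ {N} → SearchProtocol N → Vec Bool N → Vec Bool N → Set
FindsDifference P u v = ∃[ i ] (run P u v ≡ just i × lookup u i ≢ lookup v i)

Solves : ∀ N → ℕ → (Vec Bool N → Vec Bool N → Set) → Set
Solves N d R = Σ (SearchProtocol N) λ P → cost P ≤ d × (∀ u v → R u v → FindsDifference P u v)

KW : ∀ N → ℕ → (Vec Bool N → Bool) → Set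
KW N d f = Solves N d (λ u v → f u ≢ f v)

module _ {N : ℕ} where

  solves-weaken : ∀ {d d′ R} → d ≤ d′ → Solves N d R → Solves N d′ R
  solves-weaken d≤d′ (P , c , h) = P , ℕ.≤-trans c d≤d′ , h

  solves-⊆ : ∀ {d R R′} → (∀ {u v} → R u v → R′ u v) → Solves N d R′ → Solves N d R
  solves-⊆ R⊆R′ (P , c , h) = P , c , λ u v r → h u v (R⊆R′ r)

  solves-⊥ : ∀ {d} → Solves N d (λ _ _ → ⊥)
  solves-⊥ = leaf nothing , z≤n , λ _ _ ()

  kw-const : ∀ {d} b → KW N d (λ _ → b)
  kw-const b = solves-⊆ (λ ne → ne refl) solves-⊥

  kw-lookup : ∀ i → KW N 0 (λ u → lookup u i)
  kw-lookup i = leaf (just i) , z≤n , λ u v ne → i , refl , ne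

  -- Both players announce f; if the values differ they play the game of f, otherwise they go on.
  kw-test : ∀ {d e R R′} (f : Vec Bool N → Bool) → KW N d f → Solves N (e + d) R′ →
            (∀ u v → R u v → f u ≢ f v ⊎ R′ u v) → Solves N (2 + e + d) R
  kw-test {d} {e} {R} {R′} f (Pf , cf , hf) (P′ , c′ , h′) split = P , c , correct
    where
    P : SearchProtocol N
    P = sendI f (sendII f P′ Pf) (sendII f Pf P′)
    c : cost P ≤ 2 + e + d
    c = s≤s (ℕ.⊔-lub (s≤s (ℕ.⊔-lub c′ cf′)) (s≤s (ℕ.⊔-lub cf′ c′)))
      where cf′ = ℕ.≤-trans cf (ℕ.m≤n+m d e)
    continue : ∀ u v → R u v → f u ≡ f v → FindsDifference P′ u v
    continue u v r eq = [ (λ ne → ⊥-elim (ne eq)) , h′ u v ]′ (split u v r)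
    correct : ∀ u v → R u v → FindsDifference P u v
    correct u v r with f u in eu
    ... | true with f v in ev
    ...   | true  = continue u v r (trans eu (sym ev))
    ...   | false = hf u v (subst₂ _≢_ (sym eu) (sym ev) λ ())
    correct u v r | false with f v in ev
    ...   | false = continue u v r (trans eu (sym ev))
    ...   | true  = hf u v (subst₂ _≢_ (sym eu) (sym ev) λ ())

  kw-gate₃ : ∀ {d} (g : Bool → Bool → Bool → Bool) {f₁ f₂ f₃ : Vec Bool N → Bool} →
             KW N d f₁ → KW N d f₂ → KW N d f₃ → KW N (4 + d) (λ u → g (f₁ u) (f₂ u) (f₃ u))
  kw-gate₃ g {f₁} {f₂} {f₃} kw₁ kw₂ kw₃ =
    kw-test f₁ kw₁ (kw-test f₂ kw₂ kw₃ λ _ _ → id) inputDiffers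
    where
    inputDiffers : ∀ u v → g (f₁ u) (f₂ u) (f₃ u) ≢ g (f₁ v) (f₂ v) (f₃ v) →
                   f₁ u ≢ f₁ v ⊎ f₂ u ≢ f₂ v ⊎ f₃ u ≢ f₃ v
    inputDiffers u v ne with f₁ u Bool.≟ f₁ v | f₂ u Bool.≟ f₂ v | f₃ u Bool.≟ f₃ v
    ... | no  n₁ | _      | _      = inj₁ n₁
    ... | yes _  | no n₂  | _      = inj₂ (inj₁ n₂)
    ... | yes _  | yes _  | no n₃  = inj₂ (inj₂ n₃)
    ... | yes e₁ | yes e₂ | yes e₃ = ⊥-elim (ne (cong₂ (λ a (b , c) → g a b c) e₁ (cong₂ _,_ e₂ e₃)))

solves-reindex : ∀ {N N′ d R} (π : Vec Bool N′ → Vec Bool N) (ι : Fin N → Fin N′) →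
                 (∀ u i → lookup (π u) i ≡ lookup u (ι i)) →
                 Solves N d R → Solves N′ d (λ u v → R (π u) (π v))
solves-reindex {R = R} π ι lookup-π (P , c , h) =
  P′ , ℕ.≤-trans (cost-<$> _ _) (subst (_≤ _) (sym (cost-comap π π P)) c) , correct
  where
  P′ = Maybe.map ι <$> comap π π P
  correct : ∀ u v → R (π u) (π v) → FindsDifference P′ u v
  correct u v r with h (π u) (π v) r
  ... | i , ran-i , ne = ι i , run-P′ , λ eq → ne (trans (lookup-π u i) (trans eq (sym (lookup-π v i))))
    where
    run-P′ = begin
      run P′ u v                               ≡⟨ run-<$> (Maybe.map ι) (comap π π P) u v ⟩
      Maybe.map ι (run (comap π π P) u v)      ≡⟨ cong (Maybe.map ι) (run-comap π π P u v) ⟩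
      Maybe.map ι (run P (π u) (π v))          ≡⟨ cong (Maybe.map ι) ran-i ⟩
      just (ι i)                               ∎
      where open ≡-Reasoning

lookup-take : ∀ {A : Set} m {p} (xs : Vec A (m + p)) i → lookup (Vec.take m xs) i ≡ lookup xs (i ↑ˡ p)
lookup-take m xs i = trans (sym (Vec.lookup-++ˡ (Vec.take m xs) (Vec.drop m xs) i))
                           (cong (λ ys → lookup ys (i ↑ˡ _)) (Vec.take++drop≡id m xs))

lookup-drop : ∀ {A : Set} m {p} (xs : Vec A (m + p)) i → lookup (Vec.drop m xs) i ≡ lookup xs (m ↑ʳ i)
lookup-drop m xs i = trans (sym (Vec.lookup-++ʳ (Vec.take m xs) (Vec.drop m xs) i))
                           (cong (λ ys → lookup ys (m ↑ʳ i)) (Vec.take++drop≡id m xs))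

solves-take : ∀ {m p d R} → Solves m d R → Solves (m + p) d (λ u v → R (Vec.take m u) (Vec.take m v))
solves-take {m} = solves-reindex (Vec.take m) (_↑ˡ _) (lookup-take m)

solves-drop : ∀ {m p d R} → Solves p d R → Solves (m + p) d (λ u v → R (Vec.drop m u) (Vec.drop m v))
solves-drop {m} = solves-reindex (Vec.drop m) (m ↑ʳ_) (lookup-drop m)

KWBits : ∀ N → ℕ → ∀ {W} → (Vec Bool N → Vec Bool W) → Set
KWBits N d {zero}  F = ⊤
KWBits N d {suc W} F = KW N d (Vec.head ∘ F) × KWBits N d (Vec.tail ∘ F)

kwBits-weaken : ∀ {N d d′ W} {F : Vec Bool N → Vec Bool W} → d ≤ d′ → KWBits N d F → KWBits N d′ F
kwBits-weaken {W = zero}  _    _          = tt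
kwBits-weaken {W = suc W} d≤d′ (kw , kws) = solves-weaken d≤d′ kw , kwBits-weaken d≤d′ kws

kwBits-take : ∀ {m p d W} {F : Vec Bool m → Vec Bool W} →
              KWBits m d F → KWBits (m + p) d (F ∘ Vec.take m)
kwBits-take {W = zero}  _          = tt
kwBits-take {W = suc W} (kw , kws) = solves-take kw , kwBits-take kws

kwBits-drop : ∀ {m p d W} {F : Vec Bool p → Vec Bool W} →
              KWBits p d F → KWBits (m + p) d (F ∘ Vec.drop m)
kwBits-drop {W = zero}  _          = tt
kwBits-drop {W = suc W} (kw , kws) = solves-drop kw , kwBits-drop kws

kwBits-const : ∀ {N d W} (bs : Vec Bool W) → KWBits N d (λ _ → bs)
kwBits-const {W = zero}  _  = tt
kwBits-const {W = suc W} bs = kw-const (Vec.head bs) , kwBits-const (Vec.tail bs)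

≢-head-or-tail : ∀ {W} {xs ys : Vec Bool (suc W)} → xs ≢ ys →
                 Vec.head xs ≢ Vec.head ys ⊎ Vec.tail xs ≢ Vec.tail ys
≢-head-or-tail {xs = x ∷ xs} {y ∷ ys} xs≢ys with x Bool.≟ y
... | no  x≢y  = inj₁ x≢y
... | yes refl = inj₂ (xs≢ys ∘ cong (x ∷_))

-- The players compare the bits of F one by one and play the game of the first differing bit.
kwBits-scan : ∀ {N d e W R R′} (F : Vec Bool N → Vec Bool W) → KWBits N d F → Solves N (e + d) R′ →
              (∀ u v → R u v → F u ≢ F v ⊎ R′ u v) → Solves N (W * 2 + e + d) R
kwBits-scan {W = zero} F _ solves′ split =
  solves-⊆ (λ {u} {v} r → [ (λ ne → ⊥-elim (ne (empty (F u) (F v)))) , id ]′ (split u v r)) solves′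
  where
  empty : (xs ys : Vec Bool 0) → xs ≡ ys
  empty [] [] = refl
kwBits-scan {W = suc W} {R = R} {R′} F (kw , kws) solves′ split =
  kw-test (Vec.head ∘ F) kw (kwBits-scan (Vec.tail ∘ F) kws solves′ (λ _ _ → id)) split′
  where
  split′ : ∀ u v → R u v → Vec.head (F u) ≢ Vec.head (F v) ⊎ Vec.tail (F u) ≢ Vec.tail (F v) ⊎ R′ u v
  split′ u v r with split u v r
  ... | inj₂ r′    = inj₂ (inj₂ r′)
  ... | inj₁ F≢F  with ≢-head-or-tail F≢F
  ...   | inj₁ h≢h = inj₁ h≢h
  ...   | inj₂ t≢t = inj₂ (inj₁ t≢t)

xor₃ : Bool → Bool → Bool → Bool
xor₃ a b c = a Bool.xor (b Bool.xor c)

maj₃ : Bool → Bool → Bool → Bool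
maj₃ a b c = (a ∧ b) ∨ (c ∧ (a ∨ b))

full-adder : ∀ a b c → boolToℕ (xor₃ a b c) + 2 * boolToℕ (maj₃ a b c) ≡ boolToℕ a + boolToℕ b + boolToℕ c
full-adder true  true  true  = refl
full-adder true  true  false = refl
full-adder true  false true  = refl
full-adder true  false false = refl
full-adder false true  true  = refl
full-adder false true  false = refl
full-adder false false true  = refl
full-adder false false false = refl

-- A carry-save adder turns three numbers into two with the same sum, with constant depth per bit.
sumBits : ∀ {W} → Vec Bool W → Vec Bool W → Vec Bool W → Vec Bool (suc W)
sumBits {zero}  _ _ _ = false ∷ []
sumBits {suc W} a b c =
  xor₃ (Vec.head a) (Vec.head b) (Vec.head c) ∷ sumBits (Vec.tail a) (Vec.tail b) (Vec.tail c)

majBits : ∀ {W} → Vec Bool W → Vec Bool W → Vec Bool W → Vec Bool W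
majBits {zero}  _ _ _ = []
majBits {suc W} a b c =
  maj₃ (Vec.head a) (Vec.head b) (Vec.head c) ∷ majBits (Vec.tail a) (Vec.tail b) (Vec.tail c)

carryBits : ∀ {W} → Vec Bool W → Vec Bool W → Vec Bool W → Vec Bool (suc W)
carryBits a b c = false ∷ majBits a b c

fromBits-carrySave : ∀ {W} (a b c : Vec Bool W) →
                     fromBits (sumBits a b c) + fromBits (carryBits a b c) ≡ fromBits a + fromBits b + fromBits c
fromBits-carrySave {zero}  a b c = refl
fromBits-carrySave {suc W} a b c = begin
  (x + 2 * S) + 2 * (m + 2 * M)                 ≡⟨ regroup x S m M ⟩
  (x + 2 * m) + 2 * (S + 2 * M)                 ≡⟨ cong₂ (λ p q → p + 2 * q) (full-adder a₀ b₀ c₀)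
                                                         (fromBits-carrySave (Vec.tail a) (Vec.tail b) (Vec.tail c)) ⟩
  (A₀ + B₀ + C₀) + 2 * (A + B + C)              ≡⟨ distribute A₀ B₀ C₀ A B C ⟩
  (A₀ + 2 * A) + (B₀ + 2 * B) + (C₀ + 2 * C)   ∎
  where
  open ≡-Reasoning
  a₀ = Vec.head a
  b₀ = Vec.head b
  c₀ = Vec.head c
  x = boolToℕ (xor₃ a₀ b₀ c₀)
  m = boolToℕ (maj₃ a₀ b₀ c₀)
  S = fromBits (sumBits (Vec.tail a) (Vec.tail b) (Vec.tail c))
  M = fromBits (majBits (Vec.tail a) (Vec.tail b) (Vec.tail c))
  A₀ = boolToℕ a₀
  B₀ = boolToℕ b₀
  C₀ = boolToℕ c₀
  A = fromBits (Vec.tail a)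
  B = fromBits (Vec.tail b)
  C = fromBits (Vec.tail c)
  regroup : ∀ x S m M → (x + 2 * S) + 2 * (m + 2 * M) ≡ (x + 2 * m) + 2 * (S + 2 * M)
  regroup = solve-∀
  distribute : ∀ A₀ B₀ C₀ A B C →
               (A₀ + B₀ + C₀) + 2 * (A + B + C) ≡ (A₀ + 2 * A) + (B₀ + 2 * B) + (C₀ + 2 * C)
  distribute = solve-∀

module _ {N : ℕ} where

  kwBits-sum : ∀ {d W} {F G H : Vec Bool N → Vec Bool W} → KWBits N d F → KWBits N d G → KWBits N d H →
               KWBits N (4 + d) (λ u → sumBits (F u) (G u) (H u))
  kwBits-sum {W = zero}  _          _          _          = kw-const false , tt
  kwBits-sum {W = suc W} (kf , kfs) (kg , kgs) (kh , khs) = kw-gate₃ xor₃ kf kg kh , kwBits-sum kfs kgs khs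

  kwBits-maj : ∀ {d W} {F G H : Vec Bool N → Vec Bool W} → KWBits N d F → KWBits N d G → KWBits N d H →
               KWBits N (4 + d) (λ u → majBits (F u) (G u) (H u))
  kwBits-maj {W = zero}  _          _          _          = tt
  kwBits-maj {W = suc W} (kf , kfs) (kg , kgs) (kh , khs) = kw-gate₃ maj₃ kf kg kh , kwBits-maj kfs kgs khs

  kwBits-carry : ∀ {d W} {F G H : Vec Bool N → Vec Bool W} → KWBits N d F → KWBits N d G → KWBits N d H →
                 KWBits N (4 + d) (λ u → carryBits (F u) (G u) (H u))
  kwBits-carry kf kg kh = kw-const false , kwBits-maj kf kg kh

padBits : ∀ {W} → Vec Bool W → Vec Bool (suc W)
padBits {zero}  _  = false ∷ []
padBits {suc W} bs = Vec.head bs ∷ padBits (Vec.tail bs)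

fromBits-pad : ∀ {W} (bs : Vec Bool W) → fromBits (padBits bs) ≡ fromBits bs
fromBits-pad {zero}  _  = refl
fromBits-pad {suc W} bs = cong (λ k → boolToℕ (Vec.head bs) + 2 * k) (fromBits-pad (Vec.tail bs))

kwBits-pad : ∀ {N d W} {F : Vec Bool N → Vec Bool W} → KWBits N d F → KWBits N d (padBits ∘ F)
kwBits-pad {W = zero}  _          = kw-const false , tt
kwBits-pad {W = suc W} (kw , kws) = kw , kwBits-pad kws

fromBits-replicate-false : ∀ W → fromBits (replicate W false) ≡ 0
fromBits-replicate-false zero    = refl
fromBits-replicate-false (suc W) = cong (2 *_) (fromBits-replicate-false W)

maskBits : ∀ {W} → Vec Bool W → Bool → Vec Bool W
maskBits {zero}  _  _ = []
maskBits {suc W} bs b = (Vec.head bs ∧ b) ∷ maskBits (Vec.tail bs) b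

fromBits-mask : ∀ {W} (bs : Vec Bool W) b → fromBits (maskBits bs b) ≡ boolToℕ b * fromBits bs
fromBits-mask bs true  = trans (unmasked bs) (sym (ℕ.*-identityˡ _))
  where
  unmasked : ∀ {W} (bs : Vec Bool W) → fromBits (maskBits bs true) ≡ fromBits bs
  unmasked {zero}  _  = refl
  unmasked {suc W} bs = cong₂ (λ x k → boolToℕ x + 2 * k) (Bool.∧-identityʳ (Vec.head bs)) (unmasked (Vec.tail bs))
fromBits-mask bs false = masked bs
  where
  masked : ∀ {W} (bs : Vec Bool W) → fromBits (maskBits bs false) ≡ 0
  masked {zero}  _  = refl
  masked {suc W} bs = cong₂ (λ x k → boolToℕ x + 2 * k) (Bool.∧-zeroʳ (Vec.head bs)) (masked (Vec.tail bs))

kwBits-mask : ∀ {N W} (bs : Vec Bool W) (i : Fin N) → KWBits N 0 (λ u → maskBits bs (lookup u i))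
kwBits-mask {W = zero}  _  _ = tt
kwBits-mask {W = suc W} bs i = kw-∧ (Vec.head bs) , kwBits-mask (Vec.tail bs) i
  where
  kw-∧ : ∀ b → KW _ 0 (λ u → b ∧ lookup u i)
  kw-∧ true  = kw-lookup i
  kw-∧ false = kw-const false

weightedSum : ∀ {N} → Vec ℕ N → Vec Bool N → ℕ
weightedSum []       []       = 0
weightedSum (w ∷ ws) (b ∷ bs) = w * boolToℕ b + weightedSum ws bs

weightedSum-take-drop : ∀ m {p} (ws : Vec ℕ (m + p)) (u : Vec Bool (m + p)) →
                        weightedSum ws u ≡ weightedSum (Vec.take m ws) (Vec.take m u)
                                           + weightedSum (Vec.drop m ws) (Vec.drop m u)
weightedSum-take-drop zero    ws       u       = refl
weightedSum-take-drop (suc m) (w ∷ ws) (b ∷ u) =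
  trans (cong (w * boolToℕ b +_) (weightedSum-take-drop m ws u)) (sym (ℕ.+-assoc (w * boolToℕ b) _ _))

record CarrySave (N : ℕ) (ws : Vec ℕ N) (d W : ℕ) : Set where
  field
    S C            : Vec Bool N → Vec Bool W
    kw-S           : KWBits N d S
    kw-C           : KWBits N d C
    fromBits-S+C   : ∀ u → fromBits (S u) + fromBits (C u) ≡ weightedSum ws u

carrySave-[] : ∀ {d} W → CarrySave 0 [] d W
carrySave-[] W = record
  { S = λ _ → replicate W false ; C = λ _ → replicate W false
  ; kw-S = kwBits-const _ ; kw-C = kwBits-const _
  ; fromBits-S+C = λ { [] → cong₂ _+_ (fromBits-replicate-false W) (fromBits-replicate-false W) }
  }

carrySave-[_] : ∀ {d W w} → w < 2 ^ W → CarrySave 1 (w ∷ []) d W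
carrySave-[_] {d} {W} {w} w<2^W = record
  { S = λ u → maskBits (toBits W w) (lookup u Fin.zero) ; C = λ _ → replicate W false
  ; kw-S = kwBits-weaken z≤n (kwBits-mask (toBits W w) Fin.zero) ; kw-C = kwBits-const _
  ; fromBits-S+C = λ { (b ∷ []) → begin
      fromBits (maskBits (toBits W w) b) + fromBits (replicate W false)
        ≡⟨ cong₂ _+_ (fromBits-mask (toBits W w) b) (fromBits-replicate-false W) ⟩
      boolToℕ b * fromBits (toBits W w) + 0
        ≡⟨ cong (λ k → boolToℕ b * k + 0) (fromBits-toBits W w<2^W) ⟩
      boolToℕ b * w + 0
        ≡⟨ cong (_+ 0) (ℕ.*-comm (boolToℕ b) w) ⟩
      w * boolToℕ b + 0 ∎ }
  }
  where open ≡-Reasoning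

-- Two layers of carry-save adders reduce the four numbers of the halves to two.
carrySave-merge : ∀ {m p d W} (ws : Vec ℕ (m + p)) →
                  CarrySave m (Vec.take m ws) d W → CarrySave p (Vec.drop m ws) d W →
                  CarrySave (m + p) ws (8 + d) (2 + W)
carrySave-merge {m} {p} {d} {W} ws left right = record
  { S = λ u → sumBits (S₁ u) (C₁ u) (C₂′ u)
  ; C = λ u → carryBits (S₁ u) (C₁ u) (C₂′ u)
  ; kw-S = kwBits-sum {F = S₁} {C₁} {C₂′} kw-S₁ kw-C₁ kw-C₂′
  ; kw-C = kwBits-carry {F = S₁} {C₁} {C₂′} kw-S₁ kw-C₁ kw-C₂′
  ; fromBits-S+C = sums
  }
  where
  module L = CarrySave left
  module R = CarrySave right
  A B D E : Vec Bool (m + p) → Vec Bool W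
  A = L.S ∘ Vec.take m
  B = L.C ∘ Vec.take m
  D = R.S ∘ Vec.drop m
  E = R.C ∘ Vec.drop m
  S₁ C₁ C₂′ : Vec Bool (m + p) → Vec Bool (suc W)
  S₁ u = sumBits (A u) (B u) (D u)
  C₁ u = carryBits (A u) (B u) (D u)
  C₂′ = padBits ∘ E
  kw-A : KWBits (m + p) d A
  kw-A = kwBits-take L.kw-S
  kw-B : KWBits (m + p) d B
  kw-B = kwBits-take L.kw-C
  kw-D : KWBits (m + p) d D
  kw-D = kwBits-drop R.kw-S
  kw-S₁ : KWBits (m + p) (4 + d) S₁
  kw-S₁ = kwBits-sum {F = A} {B} {D} kw-A kw-B kw-D
  kw-C₁ : KWBits (m + p) (4 + d) C₁
  kw-C₁ = kwBits-carry {F = A} {B} {D} kw-A kw-B kw-D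
  kw-C₂′ : KWBits (m + p) (4 + d) C₂′
  kw-C₂′ = kwBits-weaken {F = C₂′} (ℕ.m≤n+m d 4) (kwBits-pad {F = E} (kwBits-drop R.kw-C))
  sums : ∀ u → fromBits (sumBits (S₁ u) (C₁ u) (C₂′ u)) + fromBits (carryBits (S₁ u) (C₁ u) (C₂′ u))
             ≡ weightedSum ws u
  sums u = begin
    fromBits (sumBits (S₁ u) (C₁ u) (C₂′ u)) + fromBits (carryBits (S₁ u) (C₁ u) (C₂′ u))
      ≡⟨ fromBits-carrySave (S₁ u) (C₁ u) (C₂′ u) ⟩
    fromBits (S₁ u) + fromBits (C₁ u) + fromBits (C₂′ u)
      ≡⟨ cong₂ _+_ (fromBits-carrySave (A u) (B u) (D u)) (fromBits-pad (E u)) ⟩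
    fromBits (A u) + fromBits (B u) + fromBits (D u) + fromBits (E u)
      ≡⟨ ℕ.+-assoc (fromBits (A u) + fromBits (B u)) _ _ ⟩
    (fromBits (A u) + fromBits (B u)) + (fromBits (D u) + fromBits (E u))
      ≡⟨ cong₂ _+_ (L.fromBits-S+C (Vec.take m u)) (R.fromBits-S+C (Vec.drop m u)) ⟩
    weightedSum (Vec.take m ws) (Vec.take m u) + weightedSum (Vec.drop m ws) (Vec.drop m u)
      ≡⟨ sym (weightedSum-take-drop m ws u) ⟩
    weightedSum ws u ∎
    where open ≡-Reasoning

⌈n+n/2⌉≡n : ∀ m → ℕ.⌈ m + m /2⌉ ≡ m
⌈n+n/2⌉≡n zero    = refl
⌈n+n/2⌉≡n (suc m) = cong suc (trans (cong ⌊_/2⌋ (ℕ.+-suc m m)) (⌈n+n/2⌉≡n m))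

-- Costs are written L * 8 rather than 8 * L so that suc L * 8 unfolds to 8 + L * 8.
CarrySaveTree : ℕ → ℕ → ℕ → Set
CarrySaveTree W₀ L n =
  (ws : Vec ℕ n) → (∀ i → lookup ws i < 2 ^ W₀) → CarrySave n ws (L * 8) (L * 2 + W₀)

carrySaveTree : ∀ W₀ L {n} → n ≤ 2 ^ L → CarrySaveTree W₀ L n
carrySaveTree W₀ zero    {0}           _         []       _  = carrySave-[] W₀
carrySaveTree W₀ zero    {1}           _         (w ∷ []) bd = carrySave-[ bd Fin.zero ]
carrySaveTree W₀ zero    {suc (suc n)} (s≤s ())
carrySaveTree W₀ (suc L) {n}           n≤2^1+L   = subst (CarrySaveTree W₀ (suc L)) (ℕ.⌊n/2⌋+⌈n/2⌉≡n n) split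
  where
  ⌈n/2⌉≤2^L : ℕ.⌈ n /2⌉ ≤ 2 ^ L
  ⌈n/2⌉≤2^L = ℕ.≤-trans (ℕ.⌈n/2⌉-mono (subst (n ≤_) (cong (2 ^ L +_) (ℕ.+-identityʳ (2 ^ L))) n≤2^1+L))
                        (ℕ.≤-reflexive (⌈n+n/2⌉≡n (2 ^ L)))
  ⌊n/2⌋≤2^L : ⌊ n /2⌋ ≤ 2 ^ L
  ⌊n/2⌋≤2^L = ℕ.≤-trans (ℕ.⌊n/2⌋≤⌈n/2⌉ n) ⌈n/2⌉≤2^L
  split : CarrySaveTree W₀ (suc L) (⌊ n /2⌋ + ℕ.⌈ n /2⌉)
  split ws bd = carrySave-merge ws
    (carrySaveTree W₀ L ⌊n/2⌋≤2^L (Vec.take _ ws) λ i → subst (_< 2 ^ W₀) (sym (lookup-take _ ws i)) (bd _))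
    (carrySaveTree W₀ L ⌈n/2⌉≤2^L (Vec.drop _ ws) λ i → subst (_< 2 ^ W₀) (sym (lookup-drop _ ws i)) (bd _))

solves-carrySave : ∀ {N ws d e W R R′} → CarrySave N ws d W → Solves N (e + d) R′ →
                   (∀ u v → R u v → weightedSum ws u ≢ weightedSum ws v ⊎ R′ u v) →
                   Solves N (W * 2 + (W * 2 + e) + d) R
solves-carrySave {N} {ws} {R = R} {R′} cs solves′ split =
  kwBits-scan S kw-S (kwBits-scan C kw-C solves′ λ _ _ → id) split′
  where
  open CarrySave cs
  split′ : ∀ u v → R u v → S u ≢ S v ⊎ C u ≢ C v ⊎ R′ u v
  split′ u v r with split u v r
  ... | inj₂ r′ = inj₂ (inj₂ r′)
  ... | inj₁ sums≢ with Vec.≡-dec Bool._≟_ (S u) (S v) | Vec.≡-dec Bool._≟_ (C u) (C v)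
  ...   | no S≢  | _      = inj₁ S≢
  ...   | yes _  | no C≢  = inj₂ (inj₁ C≢)
  ...   | yes S≡ | yes C≡ = ⊥-elim (sums≢ (begin
    weightedSum ws u              ≡⟨ sym (fromBits-S+C u) ⟩
    fromBits (S u) + fromBits (C u) ≡⟨ cong₂ (λ s c → fromBits s + fromBits c) S≡ C≡ ⟩
    fromBits (S v) + fromBits (C v) ≡⟨ fromBits-S+C v ⟩
    weightedSum ws v              ∎))
    where open ≡-Reasoning

positivePart negativePart : ℤ → ℕ
positivePart (ℤ.+ m)  = m
positivePart -[1+ _ ] = 0
negativePart (ℤ.+ _)  = 0
negativePart -[1+ m ] = suc m

dot-positive-negative : ∀ {n} (a : Vec ℤ n) (u : Vec Bool n) →
  dot a u ≡ ℤ.+ weightedSum (Vec.map positivePart a) u ℤ.- ℤ.+ weightedSum (Vec.map negativePart a) u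
dot-positive-negative []      []      = refl
dot-positive-negative (x ∷ a) (b ∷ u) = begin
  x ℤ.* bit b ℤ.+ dot a u
    ≡⟨ cong₂ ℤ._+_ (term x b) (dot-positive-negative a u) ⟩
  (ℤ.+ (x⁺ * b′) ℤ.- ℤ.+ (x⁻ * b′)) ℤ.+ (ℤ.+ P ℤ.- ℤ.+ Q)
    ≡⟨ regroup (ℤ.+ (x⁺ * b′)) (ℤ.+ (x⁻ * b′)) (ℤ.+ P) (ℤ.+ Q) ⟩
  (ℤ.+ (x⁺ * b′) ℤ.+ ℤ.+ P) ℤ.- (ℤ.+ (x⁻ * b′) ℤ.+ ℤ.+ Q)
    ≡⟨ sym (cong₂ ℤ._-_ (ℤ.pos-+ (x⁺ * b′) P) (ℤ.pos-+ (x⁻ * b′) Q)) ⟩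
  ℤ.+ (x⁺ * b′ + P) ℤ.- ℤ.+ (x⁻ * b′ + Q) ∎
  where
  open ≡-Reasoning
  x⁺ = positivePart x
  x⁻ = negativePart x
  b′ = boolToℕ b
  P = weightedSum (Vec.map positivePart a) u
  Q = weightedSum (Vec.map negativePart a) u
  regroup : ∀ a b c d → (a ℤ.- b) ℤ.+ (c ℤ.- d) ≡ (a ℤ.+ c) ℤ.- (b ℤ.+ d)
  regroup = ℤ-solve-∀
  term : ∀ x b → x ℤ.* bit b ≡ ℤ.+ (positivePart x * boolToℕ b) ℤ.- ℤ.+ (negativePart x * boolToℕ b)
  term x b = begin
    x ℤ.* bit b
      ≡⟨ cong₂ ℤ._*_ (parts x) (bit≡boolToℕ b) ⟩
    (ℤ.+ positivePart x ℤ.- ℤ.+ negativePart x) ℤ.* ℤ.+ boolToℕ b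
      ≡⟨ distribute (ℤ.+ positivePart x) (ℤ.+ negativePart x) (ℤ.+ boolToℕ b) ⟩
    ℤ.+ positivePart x ℤ.* ℤ.+ boolToℕ b ℤ.- ℤ.+ negativePart x ℤ.* ℤ.+ boolToℕ b
      ≡⟨ sym (cong₂ ℤ._-_ (ℤ.pos-* (positivePart x) (boolToℕ b)) (ℤ.pos-* (negativePart x) (boolToℕ b))) ⟩
    ℤ.+ (positivePart x * boolToℕ b) ℤ.- ℤ.+ (negativePart x * boolToℕ b) ∎
    where
    parts : ∀ x → x ≡ ℤ.+ positivePart x ℤ.- ℤ.+ negativePart x
    parts (ℤ.+ m)  = sym (ℤ.+-identityʳ (ℤ.+ m))
    parts -[1+ m ] = refl
    bit≡boolToℕ : ∀ b → bit b ≡ ℤ.+ boolToℕ b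
    bit≡boolToℕ true  = refl
    bit≡boolToℕ false = refl
    distribute : ∀ p q r → (p ℤ.- q) ℤ.* r ≡ p ℤ.* r ℤ.- q ℤ.* r
    distribute = ℤ-solve-∀

n<2^n : ∀ n → n < 2 ^ n
n<2^n zero    = s≤s z≤n
n<2^n (suc n) = ℕ.+-mono-≤ (ℕ.m^n>0 2 n) (subst (suc n ≤_) (sym (ℕ.+-identityʳ (2 ^ n))) (n<2^n n))

kw-dot : ∀ c L {n} → n ≤ 2 ^ L → (a : Vec ℤ n) → VAll.All (λ z → ∣ z ∣ ≤ c) a →
         Solves n ((L * 2 + c) * 8 + L * 8) (λ u v → dot a u ≢ dot a v)
kw-dot c L n≤2^L a a≤c =
  solves-weaken (ℕ.≤-reflexive (cong (_+ L * 8) (cost-identity (L * 2 + c))))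
    (solves-carrySave (tree positivePart (λ { (ℤ.+ _) → ℕ.≤-refl ; -[1+ _ ] → z≤n }))
      (solves-carrySave (tree negativePart (λ { (ℤ.+ _) → z≤n ; -[1+ _ ] → ℕ.≤-refl })) solves-⊥ λ _ _ → inj₁)
      split)
  where
  tree : ∀ (part : ℤ → ℕ) → (∀ z → part z ≤ ∣ z ∣) → CarrySave _ (Vec.map part a) (L * 8) (L * 2 + c)
  tree part part≤∣∣ = carrySaveTree c L n≤2^L (Vec.map part a) λ i →
    subst (_< 2 ^ c) (sym (Vec.lookup-map i part a))
      (ℕ.≤-<-trans (ℕ.≤-trans (part≤∣∣ (lookup a i)) (VAll.lookup⁺ a≤c i)) (n<2^n c))
  cost-identity : ∀ W → W * 2 + (W * 2 + (W * 2 + (W * 2 + 0))) ≡ W * 8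
  cost-identity = solve-∀
  split : ∀ u v → dot a u ≢ dot a v →
          weightedSum (Vec.map positivePart a) u ≢ weightedSum (Vec.map positivePart a) v ⊎
          weightedSum (Vec.map negativePart a) u ≢ weightedSum (Vec.map negativePart a) v
  split u v dot≢ with weightedSum (Vec.map positivePart a) u ℕ.≟ weightedSum (Vec.map positivePart a) v
  ... | no  P≢ = inj₁ P≢
  ... | yes P≡ = inj₂ λ Q≡ → dot≢ (begin
    dot a u ≡⟨ dot-positive-negative a u ⟩
    _       ≡⟨ cong₂ (λ p q → ℤ.+ p ℤ.- ℤ.+ q) P≡ Q≡ ⟩
    _       ≡⟨ sym (dot-positive-negative a v) ⟩
    dot a v ∎)
    where open ≡-Reasoning

Decides : ℕ → (X → Y → Set) → Set
Decides {X} {Y} d A = Σ (Protocol X Y Bool) λ P → cost P ≤ d × (∀ x y → (run P x y ≡ true) ⇔ A x y)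

isYes-⇔ : ∀ {A : Set} (a? : Dec A) → (isYes a? ≡ true) ⇔ A
isYes-⇔ (yes a)  = (λ _ → a) , (λ _ → refl)
isYes-⇔ (no ¬a) = (λ ()) , (λ a → ⊥-elim (¬a a))

≡⇒⇔ : ∀ {A B : Set} → A ≡ B → A ⇔ B
≡⇒⇔ refl = id , id

⇔-sym : ∀ {A B : Set} → A ⇔ B → B ⇔ A
⇔-sym = Product.swap

⇔-trans : ∀ {A B C : Set} → A ⇔ B → B ⇔ C → A ⇔ C
⇔-trans (f , f⁻¹) (g , g⁻¹) = g ∘ f , f⁻¹ ∘ g⁻¹

Any-⇔ : ∀ {A : Set} {P Q : A → Set} {xs : List A} → (∀ x → P x ⇔ Q x) → Any P xs ⇔ Any Q xs
Any-⇔ P⇔Q = LAny.map (proj₁ (P⇔Q _)) , LAny.map (proj₂ (P⇔Q _))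

decides-⇔ : ∀ {d} {A B : X → Y → Set} → (∀ x y → A x y ⇔ B x y) → Decides d A → Decides d B
decides-⇔ A⇔B (P , c , h) = P , c , λ x y →
  proj₁ (A⇔B x y) ∘ proj₁ (h x y) , proj₂ (h x y) ∘ proj₂ (A⇔B x y)

decides-weaken : ∀ {d d′} {A : X → Y → Set} → d ≤ d′ → Decides d A → Decides d′ A
decides-weaken d≤d′ (P , c , h) = P , ℕ.≤-trans c d≤d′ , h

decides-swap : ∀ {d} {A : X → Y → Set} → Decides d A → Decides d (λ y x → A x y)
decides-swap (P , c , h) = swap P , subst (_≤ _) (sym (cost-swap P)) c , λ y x →
  subst (λ r → (r ≡ true) ⇔ _) (sym (run-swap P x y)) (h x y)

decides-I : {A : X → Set} → (∀ x → Dec (A x)) → Decides {Y = Y} 1 (λ x _ → A x)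
decides-I A? = sendI (isYes ∘ A?) (leaf true) (leaf false) , s≤s z≤n , λ x y →
  subst (λ r → (r ≡ true) ⇔ _) (sym (run-leaves x y)) (isYes-⇔ (A? x))
  where
  run-leaves : ∀ x y → run (sendI (isYes ∘ A?) (leaf true) (leaf false)) x y ≡ isYes (A? x)
  run-leaves x y with isYes (A? x)
  ... | true  = refl
  ... | false = refl

decides-II : {A : Y → Set} → (∀ y → Dec (A y)) → Decides {X = X} 1 (λ _ y → A y)
decides-II A? = decides-swap (decides-I A?)

refutes : ∀ {r : Bool} {A : Set} → (r ≡ true) ⇔ A → r ≡ false → ¬ A
refutes (_ , from) r≡false a = case trans (sym (from a)) r≡false of λ ()

decides-⊎ : ∀ {d e} {A B : X → Y → Set} → Decides d A → Decides e B → Decides (d + e) (λ x y → A x y ⊎ B x y)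
decides-⊎ {X = X} {Y} {e = e} {A} {B} (PA , cA , hA) (PB , cB , hB) =
  PA >>= next , cost->>= PA next cA cost-next , correct
  where
  next : Bool → Protocol X Y Bool
  next true  = leaf true
  next false = PB
  cost-next : ∀ b → cost (next b) ≤ e
  cost-next true  = z≤n
  cost-next false = cB
  correct : ∀ x y → (run (PA >>= next) x y ≡ true) ⇔ (A x y ⊎ B x y)
  correct x y rewrite run->>= PA next x y with run PA x y in ranA
  ... | true  = (λ _ → inj₁ (proj₁ (hA x y) ranA)) , (λ _ → refl)
  ... | false = inj₂ ∘ proj₁ (hB x y) , [ ⊥-elim ∘ refutes (hA x y) ranA , proj₂ (hB x y) ]′

decides-sendI : ∀ {e} w (f : X → Vec Bool w) {A : Vec Bool w → X → Y → Set} →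
                (∀ bs → Decides e (A bs)) → Decides (w + e) (λ x y → A (f x) x y)
decides-sendI w f decide = sendBitsI w f (proj₁ ∘ decide) ,
  cost-sendBitsI w f (proj₁ ∘ decide) (proj₁ ∘ proj₂ ∘ decide) ,
  λ x y → subst (λ r → (r ≡ true) ⇔ _) (sym (run-sendBitsI w f (proj₁ ∘ decide) x y))
                (proj₂ (proj₂ (decide (f x))) x y)

decides-Any : ∀ {d} {B : Set} {A : B → X → Y → Set} (bs : List B) →
              All (λ b → Decides d (A b)) bs → Decides (List.length bs * d) (λ x y → Any (λ b → A b x y) bs)
decides-Any []       []       = leaf false , z≤n , λ x y → (λ ()) , (λ ())
decides-Any (b ∷ bs) (decide ∷ decides) =
  decides-⇔ (λ x y → [ here , there ]′ , LAny.toSum) (decides-⊎ decide (decides-Any bs decides))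

Literal : ℕ → Set
Literal N = Fin N × Bool

Holds : ∀ {N} → Vec Bool N → Literal N → Set
Holds z (i , b) = lookup z i ≡ b

literalEq : ∀ {N} → Literal N → LinEq N
literalEq (i , b) = unitVec i ≐ bit b

clauseLiterals : ∀ {N} → List (Fin N) → List (Fin N) → List (Literal N)
clauseLiterals I J = List.map (_, true) I List.++ List.map (_, false) J

translateClause-literals : ∀ {N} (I J : List (Fin N)) → translateClause I J ≡ List.map literalEq (clauseLiterals I J)
translateClause-literals I J = sym (trans (List.map-++ literalEq (List.map (_, true) I) _)
                                          (cong₂ List._++_ (sym (List.map-∘ I)) (sym (List.map-∘ J))))

dot-zeros : ∀ {N} (z : Vec Bool N) → dot (Vec.tabulate (λ _ → ℤ.+ 0)) z ≡ ℤ.+ 0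
dot-zeros []      = refl
dot-zeros (_ ∷ z) = trans (ℤ.+-identityˡ _) (dot-zeros z)

dot-unitVec : ∀ {N} (i : Fin N) (z : Vec Bool N) → dot (unitVec i) z ≡ bit (lookup z i)
dot-unitVec Fin.zero    (b ∷ z) = trans (cong₂ ℤ._+_ (ℤ.*-identityˡ (bit b)) (dot-zeros z)) (ℤ.+-identityʳ (bit b))
dot-unitVec (Fin.suc i) (b ∷ z) =
  trans (cong (λ a → dot a (b ∷ z)) unitVec-suc) (trans (ℤ.+-identityˡ _) (dot-unitVec i z))
  where
  isYes-map′ : ∀ {A B : Set} {f : A → B} {g : B → A} (a? : Dec A) → isYes (Dec.map′ f g a?) ≡ isYes a?
  isYes-map′ (yes _) = refl
  isYes-map′ (no _)  = refl
  unitVec-suc : unitVec (Fin.suc i) ≡ ℤ.+ 0 ∷ unitVec i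
  unitVec-suc = cong (ℤ.+ 0 ∷_) (Vec.tabulate-cong (λ j → cong bit (isYes-map′ (i Fin.≟ j))))

bit-injective : ∀ {a b} → bit a ≡ bit b → a ≡ b
bit-injective {true}  {true}  _ = refl
bit-injective {false} {false} _ = refl
bit-injective {true}  {false} ()
bit-injective {false} {true}  ()

satLine-literals : ∀ {N} (ls : List (Literal N)) z → SatLine (List.map literalEq ls) z ⇔ Any (Holds z) ls
satLine-literals ls z =
  LAny.map (λ {l} → bit-injective ∘ trans (sym (dot-unitVec (proj₁ l) z))) ∘ LAny.map⁻ ,
  LAny.map⁺ ∘ LAny.map (λ {l} → trans (dot-unitVec (proj₁ l) z) ∘ cong bit)

satLine-clause : ∀ {N} (I J : List (Fin N)) z → SatLine (translateClause I J) z ⇔ Any (Holds z) (clauseLiterals I J)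
satLine-clause I J z rewrite translateClause-literals I J = satLine-literals (clauseLiterals I J) z

select : ∀ {A : Set} {N} → Vec Bool N → Vec A N → Vec A N → Vec A N
select []       []       []       = []
select (o ∷ os) (x ∷ xs) (y ∷ ys) = (if o then x else y) ∷ select os xs ys

lookup-select : ∀ {A : Set} {N} (ow : Vec Bool N) (p r : Vec A N) i →
                lookup (select ow p r) i ≡ (if lookup ow i then lookup p i else lookup r i)
lookup-select (o ∷ os) (x ∷ xs) (y ∷ ys) Fin.zero    = refl
lookup-select (o ∷ os) (x ∷ xs) (y ∷ ys) (Fin.suc i) = lookup-select os xs ys i

select-++ : ∀ {A : Set} {m k} (o₁ : Vec Bool m) (o₂ : Vec Bool k) (p₁ r₁ : Vec A m) (p₂ r₂ : Vec A k) →
            select (o₁ ++ o₂) (p₁ ++ p₂) (r₁ ++ r₂) ≡ select o₁ p₁ r₁ ++ select o₂ p₂ r₂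
select-++ []       o₂ []       []       p₂ r₂ = refl
select-++ (o ∷ o₁) o₂ (x ∷ p₁) (y ∷ r₁) p₂ r₂ = cong (_ ∷_) (select-++ o₁ o₂ p₁ r₁ p₂ r₂)

select-true : ∀ {A : Set} {m} (p r : Vec A m) → select (replicate m true) p r ≡ p
select-true []      []      = refl
select-true (x ∷ p) (_ ∷ r) = cong (x ∷_) (select-true p r)

select-false : ∀ {A : Set} {m} (p r : Vec A m) → select (replicate m false) p r ≡ r
select-false []      []      = refl
select-false (_ ∷ p) (y ∷ r) = cong (y ∷_) (select-false p r)

dot-select : ∀ {N} (ow : Vec Bool N) (a : Vec ℤ N) (p r : Vec Bool N) →
             dot a (select ow p r)
               ≡ dot a (select ow p (replicate N false)) ℤ.+ dot a (select ow (replicate N false) r)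
dot-select []         []      []      []      = refl
dot-select (true ∷ ow)  (x ∷ a) (b ∷ p) (_ ∷ r) =
  trans (cong (λ k → x ℤ.* bit b ℤ.+ k) (dot-select ow a p r)) (regroup (x ℤ.* bit b) x _ _)
  where
  regroup : ∀ y x P R → y ℤ.+ (P ℤ.+ R) ≡ (y ℤ.+ P) ℤ.+ (x ℤ.* ℤ.+ 0 ℤ.+ R)
  regroup = ℤ-solve-∀
dot-select (false ∷ ow) (x ∷ a) (_ ∷ p) (b ∷ r) =
  trans (cong (λ k → x ℤ.* bit b ℤ.+ k) (dot-select ow a p r)) (regroup (x ℤ.* bit b) x _ _)
  where
  regroup : ∀ y x P R → y ℤ.+ (P ℤ.+ R) ≡ (x ℤ.* ℤ.+ 0 ℤ.+ P) ℤ.+ (y ℤ.+ R)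
  regroup = ℤ-solve-∀

∣dot∣≤ : ∀ {c N} (a : Vec ℤ N) (z : Vec Bool N) → VAll.All (λ x → ∣ x ∣ ≤ c) a → ∣ dot a z ∣ ≤ c * N
∣dot∣≤ []      []      VAll.[] = z≤n
∣dot∣≤ {c} {suc N} (x ∷ a) (b ∷ z) (x≤c VAll.∷ a≤c) = begin
  ∣ x ℤ.* bit b ℤ.+ dot a z ∣      ≤⟨ ℤ.∣i+j∣≤∣i∣+∣j∣ (x ℤ.* bit b) (dot a z) ⟩
  ∣ x ℤ.* bit b ∣ + ∣ dot a z ∣    ≤⟨ ℕ.+-mono-≤ (ℕ.≤-trans (∣x*bit∣≤∣x∣ b) x≤c) (∣dot∣≤ a z a≤c) ⟩
  c + c * N                        ≡⟨ ℕ.*-suc c N ⟨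
  c * suc N                        ∎
  where
  open ℕ.≤-Reasoning
  ∣x*bit∣≤∣x∣ : ∀ b → ∣ x ℤ.* bit b ∣ ≤ ∣ x ∣
  ∣x*bit∣≤∣x∣ true  = ℕ.≤-reflexive (cong ∣_∣ (ℤ.*-identityʳ x))
  ∣x*bit∣≤∣x∣ false = subst (_≤ ∣ x ∣) (sym (cong ∣_∣ (ℤ.*-zeroʳ x))) z≤n

satLine-sameForm : ∀ {N} {a : Vec ℤ N} {B : Line N} z → All (λ e → coeffs e ≡ a) B →
                   Any (λ e → dot a z ≡ free e) B ⇔ SatLine B z
satLine-sameForm z []           = (λ ()) , (λ ())
satLine-sameForm z (refl ∷ all) with satLine-sameForm z all
... | to , from = LAny.fromSum ∘ Sum.map₂ to ∘ LAny.toSum , LAny.fromSum ∘ Sum.map₂ from ∘ LAny.toSum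

IsBlock : ℕ → ∀ {N} → Line N → Set
IsBlock c B = (SameForm B ⊎ IsTranslatedClause B) × CoeffBounded c B

-- Player I knows the coordinates where ow is true, Player II the others.
module Ownership {X Y : Set} {N : ℕ} (ow : Vec Bool N) (zI : X → Vec Bool N) (zII : Y → Vec Bool N) where

  Z : X → Y → Vec Bool N
  Z x y = select ow (zI x) (zII y)

  HoldsOwned : Bool → Vec Bool N → Literal N → Set
  HoldsOwned o z (i , b) = lookup ow i ≡ o × lookup z i ≡ b

  holdsOwned? : ∀ o z l → Dec (HoldsOwned o z l)
  holdsOwned? o z (i , b) = (lookup ow i Bool.≟ o) Dec.×-dec (lookup z i Bool.≟ b)

  holds-Z⇔ : ∀ x y l → Holds (Z x y) l ⇔ (HoldsOwned true (zI x) l ⊎ HoldsOwned false (zII y) l)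
  holds-Z⇔ x y (i , b) rewrite lookup-select ow (zI x) (zII y) i with lookup ow i
  ... | true  = (λ h → inj₁ (refl , h)) , [ proj₂ , (λ { (() , _) }) ]′
  ... | false = (λ h → inj₂ (refl , h)) , [ (λ { (() , _) }) , proj₂ ]′

  decides-clause : (ls : List (Literal N)) → Decides 2 (λ x y → Any (Holds (Z x y)) ls)
  decides-clause ls = decides-⇔ any⇔
    (decides-⊎ (decides-I (λ x → LAny.any? (holdsOwned? true (zI x)) ls))
               (decides-II (λ y → LAny.any? (holdsOwned? false (zII y)) ls)))
    where
    any⇔ : ∀ x y → (Any (HoldsOwned true (zI x)) ls ⊎ Any (HoldsOwned false (zII y)) ls) ⇔ Any (Holds (Z x y)) ls
    any⇔ x y = ⇔-trans (LAny.Any-⊎⁺ , LAny.Any-⊎⁻) (⇔-sym (Any-⇔ (holds-Z⇔ x y)))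

  decides-dot : ∀ {c w} (a : Vec ℤ N) → VAll.All (λ x → ∣ x ∣ ≤ c) a → c * N < 2 ^ w → (B : Line N) →
                Decides (suc w + 1) (λ x y → Any (λ e → dot a (Z x y) ≡ free e) B)
  decides-dot {w = w} a a≤c cN<2^w B = decides-⇔ received⇔
    (decides-sendI (suc w) (ℤ→bits w ∘ α) λ bs → decides-II λ y → LAny.any? (λ e → bits→ℤ bs ℤ.+ β y ℤ.≟ free e) B)
    where
    α : X → ℤ
    α x = dot a (select ow (zI x) (replicate N false))
    β : Y → ℤ
    β y = dot a (select ow (replicate N false) (zII y))
    received : ∀ x y → bits→ℤ (ℤ→bits w (α x)) ℤ.+ β y ≡ dot a (Z x y)
    received x y = trans (cong (ℤ._+ β y) (bits→ℤ-ℤ→bits w {α x} (ℕ.≤-<-trans (∣dot∣≤ a _ a≤c) cN<2^w)))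
                         (sym (dot-select ow a (zI x) (zII y)))
    received⇔ : ∀ x y → Any (λ e → bits→ℤ (ℤ→bits w (α x)) ℤ.+ β y ≡ free e) B ⇔ Any (λ e → dot a (Z x y) ≡ free e) B
    received⇔ x y = ≡⇒⇔ (cong (λ k → Any (λ e → k ≡ free e) B) (received x y))

  decides-block : ∀ {c w} (B : Line N) → IsBlock c B → c * N < 2 ^ w →
                  Decides (suc w + 1) (λ x y → SatLine B (Z x y))
  decides-block {w = w} _ (inj₂ (I , J , refl) , _) _ =
    decides-weaken (s≤s (ℕ.m≤n+m 1 w)) (decides-⇔ (λ x y → ⇔-sym (satLine-clause I J (Z x y)))
                                                  (decides-clause (clauseLiterals I J)))
  decides-block []      (inj₁ _ , _) _ = leaf false , z≤n , λ x y → (λ ()) , (λ ())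
  decides-block (e ∷ B) (inj₁ (a , all@(refl ∷ _)) , e≤c ∷ _) cN<2^w =
    decides-⇔ (λ x y → satLine-sameForm (Z x y) all) (decides-dot (coeffs e) e≤c cN<2^w (e ∷ B))

dot-++ : ∀ m {p} (a : Vec ℤ (m + p)) (z₁ : Vec Bool m) (z₂ : Vec Bool p) →
         dot a (z₁ ++ z₂) ≡ dot (Vec.take m a) z₁ ℤ.+ dot (Vec.drop m a) z₂
dot-++ zero    a       []       z₂ = sym (ℤ.+-identityˡ _)
dot-++ (suc m) (x ∷ a) (b ∷ z₁) z₂ =
  trans (cong (λ k → x ℤ.* bit b ℤ.+ k) (dot-++ m a z₁ z₂)) (sym (ℤ.+-assoc (x ℤ.* bit b) _ _))

All-take : ∀ {A : Set} {P : A → Set} m {p} {xs : Vec A (m + p)} → VAll.All P xs → VAll.All P (Vec.take m xs)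
All-take {P = P} m {xs = xs} all = VAll.lookup⁻ λ i → subst P (sym (lookup-take m xs i)) (VAll.lookup⁺ all (i ↑ˡ _))

exactlyOne-⇔ : ∀ {A A′ B B′ : Set} → A ⇔ A′ → B ⇔ B′ → ExactlyOne A B → ExactlyOne A′ B′
exactlyOne-⇔ (f , f⁻¹) (g , g⁻¹) = Sum.map (Product.map f (_∘ g⁻¹)) (Product.map (_∘ f⁻¹) g)

exactlyOne-tail : ∀ {A B C D : Set} → (A → B) → (B → A) → ExactlyOne (A ⊎ C) (B ⊎ D) → ExactlyOne C D
exactlyOne-tail A→B B→A (inj₁ (inj₁ a , ¬b⊎d)) = ⊥-elim (¬b⊎d (inj₁ (A→B a)))
exactlyOne-tail A→B B→A (inj₁ (inj₂ c , ¬b⊎d)) = inj₁ (c , ¬b⊎d ∘ inj₂)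
exactlyOne-tail A→B B→A (inj₂ (¬a⊎c , inj₁ b)) = ⊥-elim (¬a⊎c (inj₁ (B→A b)))
exactlyOne-tail A→B B→A (inj₂ (¬a⊎c , inj₂ d)) = inj₂ (¬a⊎c ∘ inj₂ , d)

indexCode : ∀ {n} → Maybe (Fin n) → ℕ
indexCode nothing  = 0
indexCode (just j) = suc (Fin.toℕ j)

indexDecode : ∀ {n} → ℕ → Maybe (Fin n)
indexDecode         zero    = nothing
indexDecode {n} (suc k) with k ℕ.<? n
... | yes k<n = just (Fin.fromℕ< k<n)
... | no  _   = nothing

indexDecode-indexCode : ∀ {n} (o : Maybe (Fin n)) → indexDecode (indexCode o) ≡ o
indexDecode-indexCode nothing = refl
indexDecode-indexCode {n} (just j) with Fin.toℕ j ℕ.<? n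
... | yes j<n = cong just (Fin.fromℕ<-toℕ j j<n)
... | no  j≮n = ⊥-elim (j≮n (Fin.toℕ<n j))

sendIndexI : ∀ {n} w → (X → Maybe (Fin n)) → Protocol X Y (Maybe (Fin n))
sendIndexI w f = sendBitsI w (toBits w ∘ indexCode ∘ f) (leaf ∘ indexDecode ∘ fromBits)

sendIndexII : ∀ {n} w → (Y → Maybe (Fin n)) → Protocol X Y (Maybe (Fin n))
sendIndexII w g = swap (sendIndexI w g)

cost-sendIndexI : ∀ {n} w (f : X → Maybe (Fin n)) → cost (sendIndexI {Y = Y} w f) ≤ w
cost-sendIndexI w f = subst (cost (sendIndexI w f) ≤_) (ℕ.+-identityʳ w)
  (cost-sendBitsI w (toBits w ∘ indexCode ∘ f) (leaf ∘ indexDecode ∘ fromBits) λ _ → z≤n)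

cost-sendIndexII : ∀ {n} w (g : Y → Maybe (Fin n)) → cost (sendIndexII {X = X} w g) ≤ w
cost-sendIndexII w g = subst (_≤ w) (sym (cost-swap (sendIndexI w g))) (cost-sendIndexI w g)

run-sendIndexI : ∀ {n} w (f : X → Maybe (Fin n)) → n < 2 ^ w → ∀ x (y : Y) → run (sendIndexI w f) x y ≡ f x
run-sendIndexI w f n<2^w x y = begin
  run (sendIndexI w f) x y                               ≡⟨ run-sendBitsI w _ _ x y ⟩
  indexDecode (fromBits (toBits w (indexCode (f x))))    ≡⟨ cong indexDecode (fromBits-toBits w code<2^w) ⟩
  indexDecode (indexCode (f x))                          ≡⟨ indexDecode-indexCode (f x) ⟩
  f x                                                    ∎
  where
  open ≡-Reasoning
  code<2^w : indexCode (f x) < 2 ^ w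
  code<2^w with f x
  ... | nothing = ℕ.≤-<-trans z≤n n<2^w
  ... | just j  = ℕ.≤-<-trans (Fin.toℕ<n j) n<2^w

run-sendIndexII : ∀ {n} w (g : Y → Maybe (Fin n)) → n < 2 ^ w → ∀ (x : X) y → run (sendIndexII w g) x y ≡ g y
run-sendIndexII w g n<2^w x y = trans (run-swap (sendIndexI w g) y x) (run-sendIndexI w g n<2^w y x)

c*N<2^[c+L] : ∀ c {N} L → N ≤ 2 ^ L → c * N < 2 ^ (c + L)
c*N<2^[c+L] c {N} L N≤2^L = begin-strict
  c * N           ≤⟨ ℕ.*-monoʳ-≤ c N≤2^L ⟩
  c * 2 ^ L       <⟨ ℕ.m<n+m (c * 2 ^ L) (ℕ.m^n>0 2 L) ⟩
  suc c * 2 ^ L   ≤⟨ ℕ.*-monoˡ-≤ (2 ^ L) (n<2^n c) ⟩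
  2 ^ c * 2 ^ L   ≡⟨ ℕ.^-distribˡ-+-* 2 c L ⟨
  2 ^ (c + L)     ∎
  where open ℕ.≤-Reasoning

-- Player I's part of a·x lies below c N < 2 ^ (c + L) in absolute value and takes c + L + 1 bits.
-- A block is searched either by kw-dot or by deciding a clause and announcing an index of suc L bits.
blockDecisionCost blockSearchCost : ℕ → ℕ → ℕ
blockDecisionCost c L = suc (c + L) + 1
blockSearchCost c L = (L * 2 + c) * 8 + L * 8 + (blockDecisionCost c L + suc L)

module Game (n s t : ℕ) where

  N : ℕ
  N = n + s + t

  U V : InI n s → InII n t → Vec Bool N
  U = assignU
  V = assignV

  Finds : Maybe (Fin n) → InI n s → InII n t → Set
  Finds o x y = ∃[ i ] (o ≡ just i × lookup (proj₁ x) i ≢ lookup (proj₁ y) i)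

  SolvesKW : ℕ → (Vec Bool N → Set) → Set
  SolvesKW d A = Σ (Protocol (InI n s) (InII n t) (Maybe (Fin n))) λ P → cost P ≤ d ×
    (∀ x y → ExactlyOne (A (U x y)) (A (V x y)) → Finds (run P x y) x y)

  -- Player I knows u and q, Player II knows r.
  module OwnU = Ownership {InI n s} {InII n t}
    (replicate (n + s) true ++ replicate t false)
    (λ (u , q) → (u ++ q) ++ replicate t false)
    (λ (v , r) → replicate (n + s) false ++ r)

  -- Player I knows q, Player II knows v and r.
  module OwnV = Ownership {InI n s} {InII n t}
    ((replicate n false ++ replicate s true) ++ replicate t false)
    (λ (u , q) → (replicate n false ++ q) ++ replicate t false)
    (λ (v , r) → (v ++ replicate s false) ++ r)

  U≡Z : ∀ x y → U x y ≡ OwnU.Z x y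
  U≡Z (u , q) (v , r) = sym (begin
    select (replicate (n + s) true ++ replicate t false)
           ((u ++ q) ++ replicate t false) (replicate (n + s) false ++ r)
      ≡⟨ select-++ (replicate (n + s) true) _ (u ++ q) _ _ r ⟩
    select (replicate (n + s) true) (u ++ q) _ ++ select (replicate t false) _ r
      ≡⟨ cong₂ _++_ (select-true (u ++ q) _) (select-false _ r) ⟩
    (u ++ q) ++ r ∎)
    where open ≡-Reasoning

  V≡Z : ∀ x y → V x y ≡ OwnV.Z x y
  V≡Z (u , q) (v , r) = sym (begin
    select ((replicate n false ++ replicate s true) ++ replicate t false)
           ((replicate n false ++ q) ++ replicate t false) ((v ++ replicate s false) ++ r)
      ≡⟨ select-++ (replicate n false ++ replicate s true) _ (replicate n false ++ q) _ _ r ⟩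
    select (replicate n false ++ replicate s true) (replicate n false ++ q) (v ++ replicate s false)
      ++ select (replicate t false) _ r
      ≡⟨ cong₂ _++_ (select-++ (replicate n false) _ (replicate n false) v q _) (select-false _ r) ⟩
    (select (replicate n false) (replicate n false) v ++ select (replicate s true) q (replicate s false))
      ++ r
      ≡⟨ cong (_++ r) (cong₂ _++_ (select-false _ v) (select-true q _)) ⟩
    (v ++ q) ++ r ∎)
    where open ≡-Reasoning

  decides-block-U : ∀ {c w} (B : Line N) → IsBlock c B → c * N < 2 ^ w →
                    Decides (suc w + 1) (λ x y → SatLine B (U x y))
  decides-block-U B ok lt = decides-⇔ (λ x y → ≡⇒⇔ (cong (SatLine B) (sym (U≡Z x y)))) (OwnU.decides-block B ok lt)

  decides-block-V : ∀ {c w} (B : Line N) → IsBlock c B → c * N < 2 ^ w →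
                    Decides (suc w + 1) (λ x y → SatLine B (V x y))
  decides-block-V B ok lt = decides-⇔ (λ x y → ≡⇒⇔ (cong (SatLine B) (sym (V≡Z x y)))) (OwnV.decides-block B ok lt)

  solvesKW-Any : ∀ {d e} {B : Set} {A : B → Vec Bool N → Set} (bs : List B) →
                 All (λ b → Decides d (λ x y → A b (U x y)) × Decides d (λ x y → A b (V x y)) × SolvesKW e (A b)) bs →
                 SolvesKW (List.length bs * (d + d) + e) (λ z → Any (λ b → A b z) bs)
  solvesKW-Any [] [] = leaf nothing , z≤n , λ x y → [ (λ { (() , _) }) , (λ { (_ , ()) }) ]′
  solvesKW-Any {d} {e} {A = A} (b ∷ bs) (((DU , cU , hU) , (DV , cV , hV) , (K , cK , hK)) ∷ kits)
    with solvesKW-Any {A = A} bs kits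
  ... | R , cR , hR = P , cP , correct
    where
    next : Bool → Bool → Protocol (InI n s) (InII n t) (Maybe (Fin n))
    next true  false = K
    next false true  = K
    next true  true  = R
    next false false = R
    P = DU >>= λ a → DV >>= next a
    cost-next : ∀ a a′ → cost (next a a′) ≤ List.length bs * (d + d) + e
    cost-next true  false = ℕ.≤-trans cK (ℕ.m≤n+m e _)
    cost-next false true  = ℕ.≤-trans cK (ℕ.m≤n+m e _)
    cost-next true  true  = cR
    cost-next false false = cR
    cP : cost P ≤ List.length (b ∷ bs) * (d + d) + e
    cP = ℕ.≤-trans (cost->>= DU _ cU λ a → cost->>= DV (next a) cV (cost-next a))
                   (ℕ.≤-reflexive (regroup d (List.length bs * (d + d)) e))
      where
      regroup : ∀ d l e → d + (d + (l + e)) ≡ d + d + l + e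
      regroup = solve-∀
    correct : ∀ x y → ExactlyOne (Any (λ b → A b (U x y)) (b ∷ bs)) (Any (λ b → A b (V x y)) (b ∷ bs)) →
              Finds (run P x y) x y
    correct x y ex rewrite run->>= DU (λ a → DV >>= next a) x y | run->>= DV (next (run DU x y)) x y
      with run DU x y in ranU | run DV x y in ranV
    ... | true  | false = hK x y (inj₁ (proj₁ (hU x y) ranU , refutes (hV x y) ranV))
    ... | false | true  = hK x y (inj₂ (refutes (hU x y) ranU , proj₁ (hV x y) ranV))
    ... | true  | true  = hR x y (exactlyOne-tail (λ _ → proj₁ (hV x y) ranV) (λ _ → proj₁ (hU x y) ranU) ex′)
      where ex′ = exactlyOne-⇔ (LAny.toSum , LAny.fromSum) (LAny.toSum , LAny.fromSum) ex
    ... | false | false =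
      hR x y (exactlyOne-tail (⊥-elim ∘ refutes (hU x y) ranU) (⊥-elim ∘ refutes (hV x y) ranV) ex′)
      where ex′ = exactlyOne-⇔ (LAny.toSum , LAny.fromSum) (LAny.toSum , LAny.fromSum) ex

  inU : Fin n → Fin N
  inU j = (j ↑ˡ s) ↑ˡ t

  lookup-inU : ∀ (u : Vec Bool n) q (r : Vec Bool t) j → lookup ((u ++ q) ++ r) (inU j) ≡ lookup u j
  lookup-inU u q r j = trans (Vec.lookup-++ˡ (u ++ q) r (j ↑ˡ s)) (Vec.lookup-++ˡ u q j)

  inU-or-shared : ∀ (u v : Vec Bool n) q (r : Vec Bool t) i →
                  (∃[ j ] inU j ≡ i) ⊎ lookup ((u ++ q) ++ r) i ≡ lookup ((v ++ q) ++ r) i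
  inU-or-shared u v q r i with Fin.splitAt (n + s) i in split₁
  ... | inj₂ k = inj₂ (begin
    lookup ((u ++ q) ++ r) i ≡⟨ Vec.lookup-splitAt (n + s) (u ++ q) r i ⟩
    [ lookup (u ++ q) , lookup r ]′ (Fin.splitAt (n + s) i) ≡⟨ cong [ lookup (u ++ q) , lookup r ]′ split₁ ⟩
    lookup r k ≡⟨ cong [ lookup (v ++ q) , lookup r ]′ split₁ ⟨
    [ lookup (v ++ q) , lookup r ]′ (Fin.splitAt (n + s) i) ≡⟨ Vec.lookup-splitAt (n + s) (v ++ q) r i ⟨
    lookup ((v ++ q) ++ r) i ∎)
    where open ≡-Reasoning
  ... | inj₁ k with Fin.splitAt n k in split₂
  ...   | inj₁ j = inj₁ (j , trans (cong (_↑ˡ t) (Fin.splitAt⁻¹-↑ˡ split₂)) (Fin.splitAt⁻¹-↑ˡ split₁))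
  ...   | inj₂ j = inj₂ (begin
    lookup ((u ++ q) ++ r) i ≡⟨ cong (lookup ((u ++ q) ++ r)) i≡ ⟨
    lookup ((u ++ q) ++ r) ((n ↑ʳ j) ↑ˡ t) ≡⟨ Vec.lookup-++ˡ (u ++ q) r _ ⟩
    lookup (u ++ q) (n ↑ʳ j) ≡⟨ Vec.lookup-++ʳ u q j ⟩
    lookup q j ≡⟨ Vec.lookup-++ʳ v q j ⟨
    lookup (v ++ q) (n ↑ʳ j) ≡⟨ Vec.lookup-++ˡ (v ++ q) r _ ⟨
    lookup ((v ++ q) ++ r) ((n ↑ʳ j) ↑ˡ t) ≡⟨ cong (lookup ((v ++ q) ++ r)) i≡ ⟩
    lookup ((v ++ q) ++ r) i ∎)
    where
    open ≡-Reasoning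
    i≡ : (n ↑ʳ j) ↑ˡ t ≡ i
    i≡ = trans (cong (_↑ˡ t) (Fin.splitAt⁻¹-↑ʳ split₂)) (Fin.splitAt⁻¹-↑ˡ split₁)

  -- Literals about u that hold; Player I detects these on its own.
  HoldsInU : Vec Bool n → Literal N → Set
  HoldsInU u (i , b) = ∃[ j ] (inU j ≡ i × lookup u j ≡ b)

  holdsInU? : ∀ u l → Dec (HoldsInU u l)
  holdsInU? u (i , b) = Fin.any? λ j → (inU j Fin.≟ i) Dec.×-dec (lookup u j Bool.≟ b)

  search : List (Literal N) → Vec Bool n → Maybe (Fin n)
  search ls u with LAny.any? (holdsInU? u) ls
  ... | yes h = just (proj₁ (proj₂ (LAny.satisfied h)))
  ... | no  _ = nothing

  module _ (u v : Vec Bool n) (q : Vec Bool s) (r : Vec Bool t) where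

    holdsInU-differs : ∀ {ls} → ¬ Any (Holds ((v ++ q) ++ r)) ls → (h : Any (HoldsInU u) ls) →
                       let j = proj₁ (proj₂ (LAny.satisfied h)) in lookup u j ≢ lookup v j
    holdsInU-differs ¬V (here (j , refl , refl)) uj≡vj = ¬V (here (trans (lookup-inU v q r j) (sym uj≡vj)))
    holdsInU-differs ¬V (there h)                      = holdsInU-differs (¬V ∘ there) h

    holdsInU-exists : ∀ {ls} → Any (Holds ((u ++ q) ++ r)) ls → ¬ Any (Holds ((v ++ q) ++ r)) ls →
                      Any (HoldsInU u) ls
    holdsInU-exists {(i , b) ∷ _} (here holdsU) ¬V with inU-or-shared u v q r i
    ... | inj₁ (j , refl) = here (j , refl , trans (sym (lookup-inU u q r j)) holdsU)
    ... | inj₂ shared     = ⊥-elim (¬V (here (trans (sym shared) holdsU)))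
    holdsInU-exists (there holdsU) ¬V = there (holdsInU-exists holdsU (¬V ∘ there))

    search-finds : ∀ ls → Any (Holds ((u ++ q) ++ r)) ls → ¬ Any (Holds ((v ++ q) ++ r)) ls →
                   ∃[ j ] (search ls u ≡ just j × lookup u j ≢ lookup v j)
    search-finds ls holdsU ¬V with LAny.any? (holdsInU? u) ls
    ... | yes h  = _ , refl , holdsInU-differs ¬V h
    ... | no ¬h = ⊥-elim (¬h (holdsInU-exists holdsU ¬V))

  solvesKW-clause : ∀ {d} w → n < 2 ^ w → (I J : List (Fin N)) →
                    Decides d (λ x y → SatLine (translateClause I J) (U x y)) →
                    SolvesKW (d + w) (SatLine (translateClause I J))
  solvesKW-clause {d} w n<2^w I J (DU , cU , hU) = P , cost->>= DU announce cU cost-announce , correct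
    where
    ls = clauseLiterals I J
    announce : Bool → Protocol (InI n s) (InII n t) (Maybe (Fin n))
    announce true  = sendIndexI w (search ls ∘ proj₁)
    announce false = sendIndexII w (search ls ∘ proj₁)
    cost-announce : ∀ b → cost (announce b) ≤ w
    cost-announce true  = cost-sendIndexI w _
    cost-announce false = cost-sendIndexII w _
    P = DU >>= announce
    correct : ∀ x y → ExactlyOne (SatLine (translateClause I J) (U x y)) (SatLine (translateClause I J) (V x y)) →
              Finds (run P x y) x y
    correct x@(u , q) y@(v , r) ex rewrite run->>= DU announce x y with run DU x y in ranU | ex
    ... | true  | inj₁ (satU , ¬satV) with search-finds u v q r ls (proj₁ (satLine-clause I J _) satU)
                                                                     (¬satV ∘ proj₂ (satLine-clause I J _))
    ...   | j , found , differs = j , trans (run-sendIndexI w _ n<2^w x y) found , differs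
    correct x y ex | true  | inj₂ (¬satU , _) = ⊥-elim (¬satU (proj₁ (hU x y) ranU))
    correct x y ex | false | inj₁ (satU , _)  = ⊥-elim (refutes (hU x y) ranU satU)
    correct x@(u , q) y@(v , r) ex | false | inj₂ (¬satU , satV)
      with search-finds v u q r ls (proj₁ (satLine-clause I J _) satV) (¬satU ∘ proj₂ (satLine-clause I J _))
    ... | j , found , differs = j , trans (run-sendIndexII w _ n<2^w x y) found , differs ∘ sym

  exactlyOne→≢ : ∀ {A : Set} (P : A → Set) {a b} → ExactlyOne (P a) (P b) → a ≢ b
  exactlyOne→≢ P (inj₁ (pa , ¬pb)) refl = ¬pb pa
  exactlyOne→≢ P (inj₂ (¬pa , pb)) refl = ¬pa pb

  solvesKW-sameForm : ∀ c L → N ≤ 2 ^ L → (B : Line N) → SameForm B → CoeffBounded c B →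
                      SolvesKW ((L * 2 + c) * 8 + L * 8) (SatLine B)
  solvesKW-sameForm c L N≤2^L []      _                        _ =
    leaf nothing , z≤n , λ x y → [ (λ { (() , _) }) , (λ { (_ , ()) }) ]′
  solvesKW-sameForm c L N≤2^L (e ∷ B) (a , all@(refl ∷ _)) (e≤c ∷ _) =
    comap proj₁ proj₁ P , subst (_≤ _) (sym (cost-comap proj₁ proj₁ P)) cP , correct
    where
    aᵤ = Vec.take n (Vec.take (n + s) a)
    n≤2^L : n ≤ 2 ^ L
    n≤2^L = ℕ.≤-trans (ℕ.≤-trans (ℕ.m≤m+n n s) (ℕ.m≤m+n (n + s) t)) N≤2^L
    kw = kw-dot c L n≤2^L aᵤ (All-take n (All-take (n + s) e≤c))
    P = proj₁ kw
    cP = proj₁ (proj₂ kw)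
    dot-split : ∀ u q r → dot a ((u ++ q) ++ r)
                        ≡ (dot aᵤ u ℤ.+ dot (Vec.drop n (Vec.take (n + s) a)) q) ℤ.+ dot (Vec.drop (n + s) a) r
    dot-split u q r = trans (dot-++ (n + s) a (u ++ q) r)
                            (cong (ℤ._+ dot (Vec.drop (n + s) a) r) (dot-++ n (Vec.take (n + s) a) u q))
    correct : ∀ x y → ExactlyOne (SatLine (e ∷ B) (U x y)) (SatLine (e ∷ B) (V x y)) →
              Finds (run (comap proj₁ proj₁ P) x y) x y
    correct x@(u , q) y@(v , r) ex with proj₂ (proj₂ kw) u v dotᵤ≢
      where
      dot≢ : dot a (U x y) ≢ dot a (V x y)
      dot≢ = exactlyOne→≢ (λ k → Any (λ e → k ≡ free e) (e ∷ B))
               (exactlyOne-⇔ (⇔-sym (satLine-sameForm _ all)) (⇔-sym (satLine-sameForm _ all)) ex)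
      dotᵤ≢ : dot aᵤ u ≢ dot aᵤ v
      dotᵤ≢ eq = dot≢ (trans (dot-split u q r) (trans (cong (λ k → (k ℤ.+ _) ℤ.+ _) eq) (sym (dot-split v q r))))
    ... | j , found , differs = j , trans (run-comap proj₁ proj₁ P x y) found , differs

  solvesKW-⇔ : ∀ {d} {A A′ : Vec Bool N → Set} → (∀ z → A z ⇔ A′ z) → SolvesKW d A → SolvesKW d A′
  solvesKW-⇔ A⇔A′ (P , c , h) = P , c , λ x y → h x y ∘ exactlyOne-⇔ (⇔-sym (A⇔A′ _)) (⇔-sym (A⇔A′ _))

  blockKit : ∀ c L → N ≤ 2 ^ L → (B : Line N) → IsBlock c B →
             Decides (blockDecisionCost c L) (λ x y → SatLine B (U x y)) ×
             Decides (blockDecisionCost c L) (λ x y → SatLine B (V x y)) ×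
             SolvesKW (blockSearchCost c L) (SatLine B)
  blockKit c L N≤2^L B ok = decideU , decides-block-V B ok cN<2^[c+L] , searchBlock (proj₁ ok)
    where
    cN<2^[c+L] = c*N<2^[c+L] c L N≤2^L
    decideU = decides-block-U B ok cN<2^[c+L]
    n<2^[1+L] : n < 2 ^ suc L
    n<2^[1+L] = ℕ.≤-<-trans (ℕ.≤-trans (ℕ.≤-trans (ℕ.m≤m+n n s) (ℕ.m≤m+n (n + s) t)) N≤2^L)
                            (ℕ.m<m+n (2 ^ L) (subst (0 <_) (sym (ℕ.+-identityʳ (2 ^ L))) (ℕ.m^n>0 2 L)))
    searchBlock : SameForm B ⊎ IsTranslatedClause B → SolvesKW (blockSearchCost c L) (SatLine B)
    searchBlock (inj₁ sameForm) with solvesKW-sameForm c L N≤2^L B sameForm (proj₂ ok)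
    ... | P , cP , h = P , ℕ.≤-trans cP (ℕ.m≤m+n _ _) , h
    searchBlock (inj₂ (I , J , refl)) with solvesKW-clause (suc L) n<2^[1+L] I J decideU
    ... | P , cP , h = P , ℕ.≤-trans cP (ℕ.m≤n+m _ _) , h

  ccLe-R0Line : ∀ c k L → N ≤ 2 ^ L → (D : Line N) → IsR0Line c k D →
                CCLe {n} {s} {t} (SatLine D)
                     (k * (blockDecisionCost c L + blockDecisionCost c L) + blockSearchCost c L)
  ccLe-R0Line c k L N≤2^L D (bounded , blocks , length≤k , shapes , perm) =
    decides-weaken ≤-task₁₂ (decides-⇔ (λ _ _ → ⇔-sym (D⇔blocks _)) (decides-Any blocks (All.map proj₁ kits))) ,
    decides-weaken ≤-task₁₂ (decides-⇔ (λ _ _ → ⇔-sym (D⇔blocks _))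
                                       (decides-Any blocks (All.map (proj₁ ∘ proj₂) kits))) ,
    Product.map₂ (Product.map₁ (λ c → ℕ.≤-trans c ≤-task₃))
                 (solvesKW-⇔ (⇔-sym ∘ D⇔blocks) (solvesKW-Any {A = SatLine} blocks kits))
    where
    d = blockDecisionCost c L
    e = blockSearchCost c L
    kits = All.map (λ {B} → blockKit c L N≤2^L B)
                   (All.zip (shapes , AllP.concat⁻ (All-resp-↭ (↭-sym perm) bounded)))
    D⇔blocks : ∀ z → SatLine D z ⇔ Any (λ B → SatLine B z) blocks
    D⇔blocks z = LAny.concat⁻ blocks ∘ Any-resp-↭ (↭-sym perm) , Any-resp-↭ perm ∘ LAny.concat⁺
    ≤-task₃ : List.length blocks * (d + d) + e ≤ k * (d + d) + e
    ≤-task₃ = ℕ.+-monoˡ-≤ e (ℕ.*-monoˡ-≤ (d + d) length≤k)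
    ≤-task₁₂ : List.length blocks * d ≤ k * (d + d) + e
    ≤-task₁₂ = ℕ.≤-trans (ℕ.*-monoʳ-≤ (List.length blocks) (ℕ.m≤m+n d d))
                         (ℕ.≤-trans (ℕ.m≤m+n _ e) ≤-task₃)

n≤2^⌈log₂n⌉ : ∀ n → n ≤ 2 ^ ⌈log₂ n ⌉
n≤2^⌈log₂n⌉ = <-rec _ step
  where
  step : ∀ n → (∀ {m} → m < n → m ≤ 2 ^ ⌈log₂ m ⌉) → n ≤ 2 ^ ⌈log₂ n ⌉
  step 0                 _   = z≤n
  step 1                 _   = s≤s z≤n
  step n@(suc (suc m))   rec = begin
    n                                         ≡⟨ ℕ.⌊n/2⌋+⌈n/2⌉≡n n ⟨
    ⌊ n /2⌋ + ℕ.⌈ n /2⌉                       ≤⟨ ℕ.+-monoˡ-≤ ℕ.⌈ n /2⌉ (ℕ.⌊n/2⌋≤⌈n/2⌉ n) ⟩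
    ℕ.⌈ n /2⌉ + ℕ.⌈ n /2⌉                     ≤⟨ ℕ.+-mono-≤ ⌈n/2⌉≤ ⌈n/2⌉≤ ⟩
    2 ^ (⌈log₂ n ⌉ ∸ 1) + 2 ^ (⌈log₂ n ⌉ ∸ 1) ≡⟨ cong (2 ^ (⌈log₂ n ⌉ ∸ 1) +_) (ℕ.+-identityʳ _) ⟨
    2 ^ ⌈log₂ n ⌉                             ∎
    where
    open ℕ.≤-Reasoning
    ⌈n/2⌉≤ : ℕ.⌈ n /2⌉ ≤ 2 ^ (⌈log₂ n ⌉ ∸ 1)
    ⌈n/2⌉≤ = subst (λ k → ℕ.⌈ n /2⌉ ≤ 2 ^ k) (⌈log₂⌈n/2⌉⌉≡⌈log₂n⌉∸1 n) (rec (ℕ.⌈n/2⌉<n m))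

ccLe-weaken : ∀ {n s t} {A : Vec Bool (n + s + t) → Set} {d d′} → d ≤ d′ → CCLe {n} {s} {t} A d → CCLe A d′
ccLe-weaken d≤d′ ((P₁ , c₁ , h₁) , (P₂ , c₂ , h₂) , (P₃ , c₃ , h₃)) =
  (P₁ , ℕ.≤-trans c₁ d≤d′ , h₁) , (P₂ , ℕ.≤-trans c₂ d≤d′ , h₂) , (P₃ , ℕ.≤-trans c₃ d≤d′ , h₃)

costConstant : ℕ → ℕ → ℕ
costConstant c k = 2 * k * c + 4 * k + 9 * c + 26

totalCost≤ : ∀ c k L → k * (blockDecisionCost c L + blockDecisionCost c L) + blockSearchCost c L
               ≤ costConstant c k * L + costConstant c k
totalCost≤ c k L =
  ℕ.≤-trans (ℕ.m≤m+n _ ((2 * k * c + 2 * k + 9 * c) * L + 23)) (ℕ.≤-reflexive (identity c k L))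
  where
  -- The slack is added on the left, turning the inequality into a semiring identity.
  identity : ∀ c k L →
    k * (suc (c + L) + 1 + (suc (c + L) + 1)) + ((L * 2 + c) * 8 + L * 8 + (suc (c + L) + 1 + suc L))
      + ((2 * k * c + 2 * k + 9 * c) * L + 23)
    ≡ (2 * k * c + 4 * k + 9 * c + 26) * L + (2 * k * c + 4 * k + 9 * c + 26)
  identity = solve-∀

lemma7p9 : (c k : ℕ) → ∃[ C ] (∀ (n s t : ℕ) (D : Line (n + s + t)) →
             IsR0Line c k D →
             CCLe {n} {s} {t} (SatLine D) (C * ⌈log₂ (n + s + t) ⌉ + C))
lemma7p9 c k = costConstant c k , λ n s t D isR0 →
  let L = ⌈log₂ (n + s + t) ⌉ in
  ccLe-weaken {A = SatLine D} (totalCost≤ c k L)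
              (Game.ccLe-R0Line n s t c k L (n≤2^⌈log₂n⌉ (n + s + t)) D isR0)
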